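{- Let $G$ be a connected graph with radius $r\geq 1$, let $u$ be a center of $G$ (a vertex of eccentricity $r$), and let $D^{r}=\{u\}$. Then $G$ has sets $D^{r-1},D^{r-2},\dots,D^{1}$, where each $D^{i}$ is a connected $i$-step dominating set of $G$, satisfying $$D^{r}\subseteq D^{r-1}\subseteq \cdots\subseteq D^{1}\subseteq D^{0}=V(G),$$ and $$rc(G)\leq \sum_{i=1}^{r}\max\{2i+1,b_i\},$$ where, for $1\leq i\leq r$, $b_i$ is the number of bridges of $G$ lying in $E(D^{i},N(D^{i}))$.
   Context: All graphs are simple, finite and undirected. For an edge-coloring of a graph $H$ (adjacent edges may receive the same color), $H$ is rainbow connected if every pair of distinct vertices is joined by a path whose edges have pairwise distinct colors; the rainbow connection number $rc(H)$ is the minimum number of colors needed. The eccentricity of $v$ is $\max_{x\in V(G)}d_G(v,x)$ and the radius is the minimum eccentricity. For $S\subseteq V(G)$, $N(S)=\{v\in V(G): d_G(v,S)=1\}$. $S$ is a $k$-step dominating set if every vertex of $G$ is at distance at most $k$ from $S$; it is connected if $G[S]$ is connected. $E(X,Y)$ is the set of edges with one end in $X$ and the other in $Y$. A bridge of $G$ is an edge whose deletion disconnects $G$. -}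

module Defs where

open import Data.Nat using (ℕ; zero; suc; _+_; _≤_; _<_; _⊔_)
open import Data.Bool using (Bool; true; false)
open import Data.Fin using (Fin; toℕ)
open import Data.Fin.Subset using (Subset; _∈_; _∉_; _⊆_; ⁅_⁆; ⊤)
open import Data.List using (List; []; _∷_; length)
open import Data.List.Relation.Unary.Unique.Propositional using (Unique)
import Data.List.Membership.Propositional as LM
open import Data.Product using (Σ; ∃; ∃-syntax; _×_; _,_)
open import Data.Sum using (_⊎_)
open import Relation.Nullary using (¬_)
open import Relation.Binary.PropositionalEquality using (_≡_; _≢_)
open import Function.Bundles using (_⇔_)

record Graph : Set where
  field
    n      : ℕ
    adj    : Fin n → Fin n → Bool
    sym    : ∀ x y → adj x y ≡ adj y x
    irrefl : ∀ x → adj x x ≡ false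
open Graph public

module _ (G : Graph) where
  V : Set
  V = Fin (n G)

  E : V → V → Set
  E x y = adj G x y ≡ true

data Walk {m : ℕ} (A : Fin m → Fin m → Set) : Fin m → Fin m → ℕ → Set where
  nil  : ∀ x → Walk A x x 0
  cons : ∀ {x y z k} → A x y → Walk A y z k → Walk A x z (suc k)

module _ (G : Graph) where

  Connected : Set
  Connected = ∀ (x y : V G) → ∃[ l ] Walk (E G) x y l

  DistLe : V G → V G → ℕ → Set
  DistLe x y k = ∃[ l ] (l ≤ k × Walk (E G) x y l)

  Ecc : V G → ℕ → Set
  Ecc v e = (∀ x → DistLe v x e) × (∀ e' → e' < e → ¬ (∀ x → DistLe v x e'))

  Radius : ℕ → Set
  Radius r = (∃[ v ] Ecc v r) × (∀ v e → Ecc v e → r ≤ e)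

  StepDominating : ℕ → Subset (n G) → Set
  StepDominating k S = ∀ v → ∃[ s ] (s ∈ S × DistLe s v k)

  InducedAdj : Subset (n G) → V G → V G → Set
  InducedAdj S x y = E G x y × x ∈ S × y ∈ S

  ConnectedSet : Subset (n G) → Set
  ConnectedSet S = ∀ x y → x ∈ S → y ∈ S → ∃[ l ] Walk (InducedAdj S) x y l

  InN : Subset (n G) → V G → Set
  InN S v = v ∉ S × ∃[ s ] (s ∈ S × E G s v)

  DelAdj : V G → V G → V G → V G → Set
  DelAdj a b x y = E G x y × ¬ ((x ≡ a × y ≡ b) ⊎ (x ≡ b × y ≡ a))

  IsBridge : V G → V G → Set
  IsBridge a b = E G a b × ¬ (∀ x y → ∃[ l ] Walk (DelAdj a b) x y l)

  BridgeIn : Subset (n G) → V G × V G → Set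
  BridgeIn S (x , y) = toℕ x < toℕ y × IsBridge x y ×
                       ((x ∈ S × InN S y) ⊎ (y ∈ S × InN S x))

  colors : ∀ {A : V G → V G → Set} {k} (c : V G → V G → Fin k) {x y l} →
           Walk A x y l → List (Fin k)
  colors c (nil _) = []
  colors c (cons {x} {y} _ w) = c x y ∷ colors c w

  RainbowConnected : ∀ {k} → (V G → V G → Fin k) → Set
  RainbowConnected c = ∀ x y → x ≢ y →
    ∃[ l ] Σ (Walk (E G) x y l) (λ w → Unique (colors {E G} c w))

  RcLe : ℕ → Set
  RcLe k = Σ (V G → V G → Fin k) λ c → (∀ x y → c x y ≡ c y x) × RainbowConnected c

CountIs : {A : Set} → (A → Set) → ℕ → Set
CountIs {A} P b = Σ (List A) λ L → Unique L × (∀ e → (e LM.∈ L) ⇔ P e) × length L ≡ b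

sum1to : (ℕ → ℕ) → ℕ → ℕ
sum1to f zero = 0
sum1to f (suc r) = sum1to f r + f (suc r)

-- D^{i−1} is grown from D^i (starting from D^r = {u}) along the breadth-first forest rooted at D^i, whose
-- subtrees hang from the neighbours of D^i. A subtree with no edge leaving it other than the one at its root
-- hangs from a bridge, which gets a colour of its own among b_i. Every other subtree is oriented so that
-- some edge leaves it into D^i or into a subtree of the opposite orientation; tree edges at level l get colour
-- l − 1 or 2i + 1 − l according to the orientation, such crossing edges get colour i, and D^{i−1} adds the
-- bridge roots and the tree paths from the crossing edges up to D^i. Then every new vertex reaches D^i by
-- two walks with colours in [0, s) and [s, 2i + 1) for some s, so any two vertices of D^{i−1} are joined, through
-- an old rainbow walk in D^i, using at most max(2i + 1, b_i) new colours.
module Submission where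

open import Data.Nat using (ℕ; zero; suc; _+_; _*_; _∸_; _≤_; _<_; _⊔_; z≤n; s≤s; _≟_; _≤?_; _<?_; NonZero; >-nonZero)
open import Data.Nat.Properties
open import Data.Nat.DivMod using (_mod_; m<n⇒m%n≡m)
open import Data.Bool using (Bool; true; false; not)
import Data.Bool as Bool
open import Data.Bool.Properties using (not-involutive)
open import Data.Maybe using (Maybe; just; nothing)
import Data.Maybe.Properties as Maybe
open import Data.Fin using (Fin; toℕ)
import Data.Fin.Properties as Fin
open import Data.Fin.Subset using (Subset; _∈_; _∉_; _⊆_; ⁅_⁆; ⊤)
open import Data.Fin.Subset.Properties using (_∈?_; x∈⁅y⁆⇒x≡y; x∈⁅x⁆; ∈⊤)
import Data.Vec as Vec
import Data.Vec.Properties as Vec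
open import Data.List using (List; []; _∷_; _++_; _∷ʳ_; reverse; map; applyUpTo; length; filter; cartesianProduct; allFin; lookup)
open import Data.List.Properties using (unfold-reverse; map-∘; map-id-local)
open import Data.List.Relation.Unary.All using (All; []; _∷_)
import Data.List.Relation.Unary.All as All
import Data.List.Relation.Unary.All.Properties as All
open import Data.List.Relation.Unary.AllPairs using ([]; _∷_)
open import Data.List.Relation.Unary.Any using (here; there)
import Data.List.Relation.Unary.Any as Any
import Data.List.Relation.Unary.Any.Properties as Any
open import Data.List.Relation.Unary.Unique.Propositional using (Unique)
import Data.List.Relation.Unary.Unique.Propositional.Properties as Unique
import Data.List.Membership.Propositional as List
import Data.List.Membership.Propositional.Properties as List
import Data.List.Membership.DecPropositional as DecMembership
open import Data.List.Relation.Binary.Disjoint.Propositional using (Disjoint)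
open import Data.List.Relation.Binary.Permutation.Propositional using (↭-sym; ↭⇒↭ₛ)
open import Data.List.Relation.Binary.Permutation.Propositional.Properties using (↭-reverse; All-resp-↭)
import Data.List.Relation.Binary.Permutation.Setoid.Properties as PermutationₛProperties
open import Data.Product using (Σ; ∃; ∃₂; _×_; _,_; proj₁; proj₂)
import Data.Product.Properties as Product
open import Data.Sum using (_⊎_; inj₁; inj₂)
import Data.Sum as Sum
open import Data.Empty using (⊥; ⊥-elim)
open import Function.Bundles using (mk⇔)
open import Relation.Nullary using (¬_; Dec; yes; no; does)
open import Relation.Nullary.Decidable using (_×-dec_; _⊎-dec_; ¬?; dec-true)
open import Relation.Unary using (Decidable)
open import Relation.Binary.Definitions using (tri<; tri≈; tri>)
open import Relation.Binary.PropositionalEquality using (_≡_; _≢_; refl; cong; cong₂; subst; trans; sym; setoid; module ≡-Reasoning)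
open import Defs hiding (sym)

private
  variable
    m k l : ℕ
    lo₁ hi₁ lo₂ hi₂ : ℕ
    xs ys : List ℕ

InRange : ℕ → ℕ → ℕ → Set
InRange lo hi c = lo ≤ c × c < hi

InRange-weaken : ∀ {lo hi lo′ hi′} → lo′ ≤ lo → hi ≤ hi′ → All (InRange lo hi) xs → All (InRange lo′ hi′) xs
InRange-weaken lo′≤lo hi≤hi′ = All.map λ (lo≤c , c<hi) → ≤-trans lo′≤lo lo≤c , <-≤-trans c<hi hi≤hi′

InRange-disjoint : All (InRange lo₁ hi₁) xs → All (InRange lo₂ hi₂) ys → hi₁ ≤ lo₂ ⊎ hi₂ ≤ lo₁ → Disjoint xs ys
InRange-disjoint xs∈ ys∈ separated (c∈xs , c∈ys) with All.lookup xs∈ c∈xs | All.lookup ys∈ c∈ys | separated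
... | _ , c<hi₁ | lo₂≤c , _ | inj₁ hi₁≤lo₂ = <-irrefl refl (<-≤-trans c<hi₁ (≤-trans hi₁≤lo₂ lo₂≤c))
... | lo₁≤c , _ | _ , c<hi₂ | inj₂ hi₂≤lo₁ = <-irrefl refl (<-≤-trans c<hi₂ (≤-trans hi₂≤lo₁ lo₁≤c))

unique-++-separated : Unique xs → All (InRange lo₁ hi₁) xs → Unique ys → All (InRange lo₂ hi₂) ys →
                      hi₁ ≤ lo₂ ⊎ hi₂ ≤ lo₁ → Unique (xs ++ ys)
unique-++-separated uxs xs∈ uys ys∈ separated = Unique.++⁺ uxs uys (InRange-disjoint xs∈ ys∈ separated)

Disjoint-++ : ∀ {zs} → Disjoint xs ys → Disjoint xs zs → Disjoint xs (ys ++ zs)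
Disjoint-++ {ys = ys} xs#ys xs#zs (c∈xs , c∈ys++zs) with List.∈-++⁻ ys c∈ys++zs
... | inj₁ c∈ys = xs#ys (c∈xs , c∈ys)
... | inj₂ c∈zs = xs#zs (c∈xs , c∈zs)

unique-around : ∀ {a b c} → a ≤ c → c < b → Unique xs → Unique ys →
                (All (InRange a c) xs × All (InRange (suc c) b) ys) ⊎ (All (InRange (suc c) b) xs × All (InRange a c) ys) →
                Unique (xs ++ c ∷ ys) × All (InRange a b) (xs ++ c ∷ ys)
unique-around {a = a} {b} {c} a≤c c<b uxs uys (inj₁ (xs∈ , ys∈)) =
  unique-++-separated uxs xs∈ (unique-++-separated {xs = c ∷ []} (All.[] ∷ []) ((≤-refl , ≤-refl) ∷ []) uys ys∈ (inj₁ ≤-refl))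
                      ((≤-refl , c<b) ∷ InRange-weaken (n≤1+n c) ≤-refl ys∈) (inj₁ ≤-refl) ,
  All.++⁺ (InRange-weaken ≤-refl (<⇒≤ c<b) xs∈) ((a≤c , c<b) ∷ InRange-weaken (≤-trans a≤c (n≤1+n c)) ≤-refl ys∈)
unique-around {a = a} {b} {c} a≤c c<b uxs uys (inj₂ (xs∈ , ys∈)) =
  unique-++-separated uxs xs∈ (unique-++-separated {xs = c ∷ []} (All.[] ∷ []) ((≤-refl , ≤-refl) ∷ []) uys ys∈ (inj₂ ≤-refl))
                      ((a≤c , ≤-refl) ∷ InRange-weaken ≤-refl (n≤1+n c) ys∈) (inj₂ ≤-refl) ,
  All.++⁺ (InRange-weaken (≤-trans a≤c (n≤1+n c)) ≤-refl xs∈) ((a≤c , c<b) ∷ InRange-weaken ≤-refl (<⇒≤ c<b) ys∈)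

unique-reverse : ∀ {A : Set} {as : List A} → Unique as → Unique (reverse as)
unique-reverse {A} {as} = PermutationₛProperties.Unique-resp-↭ (setoid A) (↭⇒↭ₛ (↭-sym (↭-reverse as)))

all-reverse : ∀ {A : Set} {P : A → Set} {as : List A} → All P as → All P (reverse as)
all-reverse {as = as} = All-resp-↭ (↭-sym (↭-reverse as))

module _ {m : ℕ} {A : Fin m → Fin m → Set} where

  infixr 5 _++ʷ_
  _++ʷ_ : ∀ {x y z} → Walk A x y k → Walk A y z l → Walk A x z (k + l)
  nil _ ++ʷ w = w
  cons e v ++ʷ w = cons e (v ++ʷ w)

  edgeColours : (Fin m → Fin m → ℕ) → ∀ {x y} → Walk A x y l → List ℕ
  edgeColours c (nil _) = []
  edgeColours c (cons {x} {y} _ w) = c x y ∷ edgeColours c w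

  edgeColours-++ : ∀ c {x y z} (v : Walk A x y k) (w : Walk A y z l) →
                   edgeColours c (v ++ʷ w) ≡ edgeColours c v ++ edgeColours c w
  edgeColours-++ c (nil _) w = refl
  edgeColours-++ c (cons e v) w = cong (_ ∷_) (edgeColours-++ c v w)

  edgeColours-subst : ∀ c {x y} (eq : k ≡ l) (w : Walk A x y k) → edgeColours c (subst (Walk A x y) eq w) ≡ edgeColours c w
  edgeColours-subst c refl w = refl

  module _ (A-sym : ∀ {x y} → A x y → A y x) where

    reverseʷ : ∀ {x y} → Walk A x y l → Walk A y x l
    reverseʷ (nil x) = nil x
    reverseʷ (cons {x} e w) = subst (Walk A _ x) (+-comm _ 1) (reverseʷ w ++ʷ cons (A-sym e) (nil x))

    edgeColours-reverse : ∀ c → (∀ x y → c x y ≡ c y x) → ∀ {x y} (w : Walk A x y l) →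
                          edgeColours c (reverseʷ w) ≡ reverse (edgeColours c w)
    edgeColours-reverse c c-sym (nil x) = refl
    edgeColours-reverse c c-sym (cons {x} {y} e w) = begin
      edgeColours c (reverseʷ (cons e w))                       ≡⟨ edgeColours-subst c (+-comm _ 1) _ ⟩
      edgeColours c (reverseʷ w ++ʷ cons (A-sym e) (nil x))     ≡⟨ edgeColours-++ c (reverseʷ w) _ ⟩
      edgeColours c (reverseʷ w) ∷ʳ c y x                       ≡⟨ cong₂ _∷ʳ_ (edgeColours-reverse c c-sym w) (c-sym y x) ⟩
      reverse (edgeColours c w) ∷ʳ c x y                        ≡⟨ sym (unfold-reverse (c x y) (edgeColours c w)) ⟩
      reverse (edgeColours c (cons e w))                        ∎
      where open ≡-Reasoning

mapʷ : ∀ {m} {A B : Fin m → Fin m → Set} → (∀ {x y} → A x y → B x y) → ∀ {x y} → Walk A x y l → Walk B x y l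
mapʷ f (nil x) = nil x
mapʷ f (cons e w) = cons (f e) (mapʷ f w)

RainbowWalk : ∀ {m} → (Fin m → Fin m → Set) → ℕ → (Fin m → Fin m → ℕ) → Fin m → Fin m → Set
RainbowWalk A q c x y = ∃₂ λ l (w : Walk A x y l) → Unique (edgeColours c w) × All (_< q) (edgeColours c w)

RainbowIn : (G : Graph) → Subset (n G) → ℕ → (V G → V G → ℕ) → Set
RainbowIn G S q c = ∀ x y → x ∈ S → y ∈ S → RainbowWalk (InducedAdj G S) q c x y

RainbowIn⇒ConnectedSet : ∀ {G S q c} → RainbowIn G S q c → ConnectedSet G S
RainbowIn⇒ConnectedSet rainbow x y x∈S y∈S = let (l , w , _) = rainbow x y x∈S y∈S in l , w

RainbowWalk-sym : ∀ {m} {A : Fin m → Fin m → Set} {q c} → (∀ {x y} → A x y → A y x) → (∀ x y → c x y ≡ c y x) →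
                  ∀ {x y} → RainbowWalk A q c x y → RainbowWalk A q c y x
RainbowWalk-sym A-sym c-sym (l , w , distinct , bounded) = l , reverseʷ A-sym w ,
  subst Unique (sym colours) (unique-reverse distinct) , subst (All _) (sym colours) (all-reverse bounded)
  where colours = edgeColours-reverse A-sym _ c-sym w

least : ∀ {P : ℕ → Set} → Decidable P → ℕ → ℕ
least P? zero = zero
least P? (suc m) with P? zero
... | yes _ = zero
... | no _ = suc (least (λ t → P? (suc t)) m)

least-holds : ∀ {P : ℕ → Set} (P? : Decidable P) m → P m → P (least P? m)
least-holds P? zero p = p
least-holds P? (suc m) p with P? zero
... | yes p₀ = p₀
... | no _ = least-holds (λ t → P? (suc t)) m p

least-≤ : ∀ {P : ℕ → Set} (P? : Decidable P) m → least P? m ≤ m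
least-≤ P? zero = z≤n
least-≤ P? (suc m) with P? zero
... | yes _ = z≤n
... | no _ = s≤s (least-≤ (λ t → P? (suc t)) m)

least-minimal : ∀ {P : ℕ → Set} (P? : Decidable P) m t → P t → least P? m ≤ t
least-minimal P? zero t p = z≤n
least-minimal P? (suc m) t p with P? zero
... | yes _ = z≤n
least-minimal P? (suc m) zero p | no ¬p₀ = ⊥-elim (¬p₀ p)
least-minimal P? (suc m) (suc t) p | no _ = s≤s (least-minimal (λ t → P? (suc t)) m t p)

suc-∸1 : 0 < m → suc (m ∸ 1) ≡ m
suc-∸1 {suc m} _ = refl

[m∸n]∸1≡m∸[1+n] : ∀ m n → m ∸ n ∸ 1 ≡ m ∸ suc n
[m∸n]∸1≡m∸[1+n] m n = trans (∸-+-assoc m n 1) (cong (m ∸_) (+-comm n 1))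

m∸n≡1+m∸[1+n] : ∀ {m n} → n < m → m ∸ n ≡ suc (m ∸ suc n)
m∸n≡1+m∸[1+n] {m} {n} n<m = trans (sym (suc-∸1 (m<n⇒0<n∸m n<m))) (cong suc ([m∸n]∸1≡m∸[1+n] m n))

module _ (G : Graph) where

  E? : ∀ x y → Dec (E G x y)
  E? x y = adj G x y Bool.≟ true

  E-sym : ∀ {x y} → E G x y → E G y x
  E-sym {x} {y} e = trans (Graph.sym G y x) e

  E⇒≢ : ∀ {x y} → E G x y → x ≢ y
  E⇒≢ {x} e refl with trans (sym e) (irrefl G x)
  ... | ()

  InducedAdj-sym : ∀ {S x y} → InducedAdj G S x y → InducedAdj G S y x
  InducedAdj-sym (e , x∈S , y∈S) = E-sym e , y∈S , x∈S

  DelAdj-sym : ∀ {a b x y} → DelAdj G a b x y → DelAdj G a b y x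
  DelAdj-sym (e , not-ab) = E-sym e , λ { (inj₁ (p , q)) → not-ab (inj₂ (q , p)) ; (inj₂ (p , q)) → not-ab (inj₁ (q , p)) }

  DelAdj-swap : ∀ {a b x y} → DelAdj G a b x y → DelAdj G b a x y
  DelAdj-swap (e , not-ab) = e , λ { (inj₁ (p , q)) → not-ab (inj₂ (p , q)) ; (inj₂ (p , q)) → not-ab (inj₁ (p , q)) }

  IsBridge-sym : ∀ {a b} → IsBridge G a b → IsBridge G b a
  IsBridge-sym (e , disconnected) = E-sym e , λ connected → disconnected λ x y →
    let (l , w) = connected x y in l , mapʷ DelAdj-swap w

module _ (G : Graph) (conn : Connected G) where

  -- splice the detour in for every use of the edge
  detour⇒¬IsBridge : ∀ {a b l} → Walk (DelAdj G a b) b a l → ¬ IsBridge G a b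
  detour⇒¬IsBridge {a} {b} detour (_ , disconnected) = disconnected λ x y → avoid (proj₂ (conn x y))
    where
      avoid : ∀ {x y l} → Walk (E G) x y l → ∃ (Walk (DelAdj G a b) x y)
      avoid (nil x) = 0 , nil x
      avoid (cons {x} {x′} e w) with avoid w | (x Fin.≟ a ×-dec x′ Fin.≟ b) ⊎-dec (x Fin.≟ b ×-dec x′ Fin.≟ a)
      ... | _ , w′ | no not-ab = _ , cons (e , not-ab) w′
      ... | _ , w′ | yes (inj₁ (refl , refl)) = _ , (reverseʷ (DelAdj-sym G) detour ++ʷ w′)
      ... | _ , w′ | yes (inj₂ (refl , refl)) = _ , (detour ++ʷ w′)

module BfsForest (G : Graph) (S : Subset (n G)) (k : ℕ) (dom : StepDominating G k S) where

  Within : ℕ → V G → Set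
  Within zero w = w ∈ S
  Within (suc t) w = Within t w ⊎ ∃ λ x → E G x w × Within t x

  within? : ∀ t w → Dec (Within t w)
  within? zero w = w ∈? S
  within? (suc t) w = within? t w ⊎-dec Fin.any? (λ x → E? G x w ×-dec within? t x)

  within-+ : ∀ {t} d {w} → Within t w → Within (d + t) w
  within-+ zero p = p
  within-+ (suc d) p = inj₁ (within-+ d p)

  within-walk : ∀ {t x z l} → Within t x → Walk (E G) x z l → Within (l + t) z
  within-walk p (nil _) = p
  within-walk {t} {z = z} {l = suc l} p (cons {x} e w) =
    subst (λ u → Within u z) (+-suc l t) (within-walk (inj₂ (x , e , p)) w)

  within-k : ∀ w → Within k w
  within-k w with dom w
  ... | s , s∈S , l , l≤k , walk =
    subst (λ u → Within u w) (m∸n+n≡m l≤k) (within-+ (k ∸ l) (subst (λ u → Within u w) (+-identityʳ l) (within-walk s∈S walk)))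

  -- d(w, S): the depth of w in the breadth-first forest grown from S
  level : V G → ℕ
  level w = least (λ t → within? t w) k

  level-within : ∀ w → Within (level w) w
  level-within w = least-holds (λ t → within? t w) k (within-k w)

  level-minimal : ∀ w t → Within t w → level w ≤ t
  level-minimal w = least-minimal (λ t → within? t w) k

  level≤k : ∀ w → level w ≤ k
  level≤k w = least-≤ (λ t → within? t w) k

  ∈S⇒level≡0 : ∀ {w} → w ∈ S → level w ≡ 0
  ∈S⇒level≡0 {w} w∈S = n≤0⇒n≡0 (level-minimal w 0 w∈S)

  level≡0⇒∈S : ∀ {w} → level w ≡ 0 → w ∈ S
  level≡0⇒∈S {w} eq = subst (λ u → Within u w) eq (level-within w)

  level>0⇒∉S : ∀ {w} → 0 < level w → w ∉ S
  level>0⇒∉S lt w∈S rewrite ∈S⇒level≡0 w∈S = <-irrefl refl lt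

  ∉S⇒level>0 : ∀ {w} → w ∉ S → 0 < level w
  ∉S⇒level>0 {w} w∉S with level w in eq
  ... | zero = ⊥-elim (w∉S (level≡0⇒∈S eq))
  ... | suc _ = s≤s z≤n

  parent : V G → V G
  parent w with w ∈? S
  ... | yes _ = w
  ... | no _ with Fin.any? (λ x → E? G x w ×-dec within? (level w ∸ 1) x)
  ...   | yes (x , _) = x
  ...   | no _ = w

  parent-∈S : ∀ {w} → w ∈ S → parent w ≡ w
  parent-∈S {w} w∈S with w ∈? S
  ... | yes _ = refl
  ... | no w∉S = ⊥-elim (w∉S w∈S)

  private
    parent-exists : ∀ w → w ∉ S → ∃ λ x → E G x w × Within (level w ∸ 1) x
    parent-exists w w∉S = from (level w) refl (level-within w)
      where
        from : ∀ t → level w ≡ t → Within t w → ∃ λ x → E G x w × Within (t ∸ 1) x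
        from zero _ w∈S = ⊥-elim (w∉S w∈S)
        from (suc t) _ (inj₂ p) = p
        from (suc t) eq (inj₁ p) = ⊥-elim (<-irrefl refl (subst (_≤ t) eq (level-minimal w t p)))

  parent-spec : ∀ {w} → w ∉ S → E G (parent w) w × suc (level (parent w)) ≡ level w
  parent-spec {w} w∉S with w ∈? S
  ... | yes w∈S = ⊥-elim (w∉S w∈S)
  ... | no _ with Fin.any? (λ x → E? G x w ×-dec within? (level w ∸ 1) x)
  ...   | no none = ⊥-elim (none (parent-exists w w∉S))
  ...   | yes (x , e , p) = e , ≤-antisym
            (subst (suc (level x) ≤_) (suc-∸1 (∉S⇒level>0 w∉S)) (s≤s (level-minimal x _ p)))
            (level-minimal w (suc (level x)) (inj₂ (x , e , level-within x)))

  parent-edge : ∀ {w} → w ∉ S → E G w (parent w)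
  parent-edge w∉S = E-sym G (proj₁ (parent-spec w∉S))

  level-parent : ∀ w → level (parent w) ≡ level w ∸ 1
  level-parent w = by-cases (w ∈? S)
    where
      by-cases : Dec (w ∈ S) → level (parent w) ≡ level w ∸ 1
      by-cases (yes w∈S) = trans (cong level (parent-∈S w∈S)) (trans (∈S⇒level≡0 w∈S) (cong (_∸ 1) (sym (∈S⇒level≡0 w∈S))))
      by-cases (no w∉S) = cong (_∸ 1) (proj₂ (parent-spec w∉S))

  parent-level< : ∀ {w} → w ∉ S → level (parent w) < level w
  parent-level< {w} w∉S = subst (level (parent w) <_) (proj₂ (parent-spec w∉S)) ≤-refl

  ≢parent∘parent : ∀ {w} → w ∉ S → w ≢ parent (parent w)
  ≢parent∘parent {w} w∉S eq = <-irrefl refl (begin-strict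
    level w                    ≡⟨ cong level eq ⟩
    level (parent (parent w))  ≡⟨ level-parent (parent w) ⟩
    level (parent w) ∸ 1       ≤⟨ m∸n≤m _ 1 ⟩
    level (parent w)           <⟨ parent-level< w∉S ⟩
    level w                    ∎)
    where open ≤-Reasoning

  level≡1⇒∉S : ∀ {v} → level v ≡ 1 → v ∉ S
  level≡1⇒∉S eq v∈S = 1+n≢0 (trans (sym eq) (∈S⇒level≡0 v∈S))

  level≡1⇒parent∈S : ∀ {v} → level v ≡ 1 → parent v ∈ S
  level≡1⇒parent∈S {v} eq = level≡0⇒∈S (trans (level-parent v) (cong (_∸ 1) eq))

  neighbour⇒level≡1 : ∀ {s v} → s ∈ S → v ∉ S → E G s v → level v ≡ 1
  neighbour⇒level≡1 {s} {v} s∈S v∉S e = ≤-antisym (level-minimal v 1 (inj₂ (s , e , s∈S))) (∉S⇒level>0 v∉S)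

  ancestor : ℕ → V G → V G
  ancestor zero w = w
  ancestor (suc j) w = ancestor j (parent w)

  level-ancestor : ∀ j w → level (ancestor j w) ≡ level w ∸ j
  level-ancestor zero w = refl
  level-ancestor (suc j) w rewrite level-ancestor j (parent w) | level-parent w = ∸-+-assoc (level w) 1 j

  ancestor-suc : ∀ j w → ancestor (suc j) w ≡ parent (ancestor j w)
  ancestor-suc zero w = refl
  ancestor-suc (suc j) w = ancestor-suc j (parent w)

  ancestor-∉S : ∀ {j w} → j < level w → ancestor j w ∉ S
  ancestor-∉S {j} {w} j<level = level>0⇒∉S (subst (0 <_) (sym (level-ancestor j w)) (m<n⇒0<n∸m j<level))

  ancestor-level-∈S : ∀ w → ancestor (level w) w ∈ S
  ancestor-level-∈S w = level≡0⇒∈S (trans (level-ancestor (level w) w) (n∸n≡0 (level w)))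

  root : V G → V G
  root w = ancestor (level w ∸ 1) w

  root-parent : ∀ w → 1 < level w → root (parent w) ≡ root w
  root-parent w 1<level rewrite level-parent w = unfold (level w ∸ 1) (∸-monoˡ-≤ 1 1<level)
    where
      unfold : ∀ m → 0 < m → ancestor (m ∸ 1) (parent w) ≡ ancestor m w
      unfold (suc m) _ = refl

  root-ancestor : ∀ j w → j < level w → root (ancestor j w) ≡ root w
  root-ancestor zero w _ = refl
  root-ancestor (suc j) w j<level = trans (root-ancestor j (parent w) j<level′) (root-parent w (≤-<-trans (s≤s z≤n) j<level))
    where
      j<level′ : j < level (parent w)
      j<level′ rewrite level-parent w = ≤-trans (s≤s ≤-refl) (∸-monoˡ-≤ 1 j<level)

  level-root : ∀ {w} → w ∉ S → level (root w) ≡ 1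
  level-root {w} w∉S = trans (level-ancestor (level w ∸ 1) w) (m∸[m∸n]≡n (∉S⇒level>0 w∉S))

  root-of-level1 : ∀ {v} → level v ≡ 1 → root v ≡ v
  root-of-level1 {v} eq = cong (λ l → ancestor (l ∸ 1) v) eq

  ancestorWalk : ∀ {R : V G → V G → Set} m z → (∀ i → i < m → R (ancestor i z) (parent (ancestor i z))) →
                 Walk R z (ancestor m z) m
  ancestorWalk zero z steps = nil z
  ancestorWalk (suc m) z steps = cons (steps 0 (s≤s z≤n)) (ancestorWalk m (parent z) (λ i i<m → steps (suc i) (s≤s i<m)))

  edgeColours-ancestorWalk : ∀ {R : V G → V G → Set} c m z steps →
    edgeColours c (ancestorWalk {R} m z steps) ≡ applyUpTo (λ i → c (ancestor i z) (parent (ancestor i z))) m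
  edgeColours-ancestorWalk c zero z steps = refl
  edgeColours-ancestorWalk c (suc m) z steps = cong (_ ∷_) (edgeColours-ancestorWalk c m (parent z) _)

fromDecidable : ∀ {m} {P : Fin m → Set} → Decidable P → Subset m
fromDecidable P? = Vec.tabulate (λ x → does (P? x))

module _ {m} {P : Fin m → Set} (P? : Decidable P) where

  ∈-fromDecidable⁺ : ∀ {x} → P x → x ∈ fromDecidable P?
  ∈-fromDecidable⁺ {x} p = Vec.lookup⇒[]= x _ (trans (Vec.lookup∘tabulate _ x) (dec-true (P? x) p))

  ∈-fromDecidable⁻ : ∀ {x} → x ∈ fromDecidable P? → P x
  ∈-fromDecidable⁻ {x} x∈ = witness (P? x) (trans (sym (Vec.lookup∘tabulate _ x)) (Vec.[]=⇒lookup x∈))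
    where
      witness : (d : Dec (P x)) → does d ≡ true → P x
      witness (yes p) _ = p

module Subtrees (G : Graph) (S : Subset (n G)) (k : ℕ) (dom : StepDominating G k S) where

  open BfsForest G S k dom public

  InSubtree : V G → V G → Set
  InSubtree v z = z ∉ S × root z ≡ v

  OutsideSubtree : V G → V G → Set
  OutsideSubtree v z′ = z′ ∈ S ⊎ root z′ ≢ v

  ExitEdge : V G → V G → V G → Set
  ExitEdge v z z′ = E G z z′ × InSubtree v z × OutsideSubtree v z′ × ¬ (z ≡ v × z′ ≡ parent v)

  exitEdge? : ∀ v z z′ → Dec (ExitEdge v z z′)
  exitEdge? v z z′ = E? G z z′ ×-dec ((¬? (z ∈? S) ×-dec (root z Fin.≟ v)) ×-dec
                     ((z′ ∈? S ⊎-dec ¬? (root z′ Fin.≟ v)) ×-dec ¬? ((z Fin.≟ v) ×-dec (z′ Fin.≟ parent v))))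

  HasExit : V G → Set
  HasExit v = ∃₂ (ExitEdge v)

  hasExit? : ∀ v → Dec (HasExit v)
  hasExit? v = Fin.any? (λ z → Fin.any? (λ z′ → exitEdge? v z z′))

  BridgeRoot : V G → Set
  BridgeRoot v = level v ≡ 1 × ¬ HasExit v

  bridgeRoot? : ∀ v → Dec (BridgeRoot v)
  bridgeRoot? v = (level v ≟ 1) ×-dec ¬? (hasExit? v)

  exit⇒level≡1 : ∀ {v z z′} → ExitEdge v z z′ → level v ≡ 1
  exit⇒level≡1 (_ , (z∉S , refl) , _) = level-root z∉S

  exit-target≢parent : ∀ {v z z′} → ExitEdge v z z′ → z′ ∈ S → z′ ≢ parent z
  exit-target≢parent {v} {z} (_ , (z∉S , root≡v) , _ , not-tree) z′∈S refl = not-tree (z≡v , cong parent z≡v)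
    where
      z≡v : z ≡ v
      z≡v = trans (sym (root-of-level1 (trans (sym (proj₂ (parent-spec z∉S))) (cong suc (∈S⇒level≡0 z′∈S))))) root≡v

  exit-target-root≢ : ∀ {v z z′} → ExitEdge v z z′ → z′ ∉ S → root z′ ≢ v
  exit-target-root≢ (_ , _ , inj₁ z′∈S , _) z′∉S = ⊥-elim (z′∉S z′∈S)
  exit-target-root≢ (_ , _ , inj₂ ne , _) _ = ne

  -- partial orientations of the subtrees, indexed by their roots (see sideColour for their meaning)
  Orientation : Set
  Orientation = V G → Maybe Bool

  Oriented : Orientation → V G → Set
  Oriented τ v = ∃ λ t → τ v ≡ just t

  _⊑_ : Orientation → Orientation → Set
  τ ⊑ τ′ = ∀ w t → τ w ≡ just t → τ′ w ≡ just t

  ⊑-refl : ∀ {τ} → τ ⊑ τ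
  ⊑-refl w t eq = eq

  ⊑-trans : ∀ {τ₁ τ₂ τ₃} → τ₁ ⊑ τ₂ → τ₂ ⊑ τ₃ → τ₁ ⊑ τ₃
  ⊑-trans τ₁⊑τ₂ τ₂⊑τ₃ w t eq = τ₂⊑τ₃ w t (τ₁⊑τ₂ w t eq)

  CrossEdge : Orientation → V G → V G → Set
  CrossEdge τ z z′ = E G z z′ × z ∉ S × Σ Bool λ t → τ (root z) ≡ just t ×
                     ((z′ ∈ S × z′ ≢ parent z) ⊎ (z′ ∉ S × τ (root z′) ≡ just (not t)))

  crossEdge? : ∀ τ z z′ → Dec (CrossEdge τ z z′)
  crossEdge? τ z z′ = E? G z z′ ×-dec (¬? (z ∈? S) ×-dec bool-any? (λ t → τ (root z) ≟ᵐ just t ×-dec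
                      ((z′ ∈? S ×-dec ¬? (z′ Fin.≟ parent z)) ⊎-dec (¬? (z′ ∈? S) ×-dec τ (root z′) ≟ᵐ just (not t)))))
    where
      _≟ᵐ_ = Maybe.≡-dec Bool._≟_
      bool-any? : ∀ {P : Bool → Set} → Decidable P → Dec (Σ Bool P)
      bool-any? P? with P? true | P? false
      ... | yes p | _ = yes (true , p)
      ... | no _ | yes p = yes (false , p)
      ... | no ¬t | no ¬f = no λ { (true , p) → ¬t p ; (false , p) → ¬f p }

  CrossEdge-mono : ∀ {τ τ′} → τ ⊑ τ′ → ∀ {z z′} → CrossEdge τ z z′ → CrossEdge τ′ z z′
  CrossEdge-mono τ⊑τ′ (e , z∉S , t , eq , inj₁ p) = e , z∉S , t , τ⊑τ′ _ t eq , inj₁ p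
  CrossEdge-mono τ⊑τ′ (e , z∉S , t , eq , inj₂ (z′∉S , eq′)) = e , z∉S , t , τ⊑τ′ _ t eq , inj₂ (z′∉S , τ⊑τ′ _ _ eq′)

  CrossFrom : Orientation → V G → Set
  CrossFrom τ v = ∃₂ λ z z′ → root z ≡ v × CrossEdge τ z z′

  Witnessed : Orientation → Set
  Witnessed τ = ∀ v → Oriented τ v → CrossFrom τ v

  witnessed-⊑ : ∀ {τ τ′} → Witnessed τ → τ ⊑ τ′ → (∀ v → Oriented τ′ v → τ v ≡ nothing → CrossFrom τ′ v) → Witnessed τ′
  witnessed-⊑ {τ} W τ⊑τ′ new v oriented with τ v in eq
  ... | just t = let (z , z′ , root≡v , cross) = W v (t , eq) in z , z′ , root≡v , CrossEdge-mono τ⊑τ′ cross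
  ... | nothing = new v oriented eq

  assign : Orientation → V G → Bool → Orientation
  assign τ v t w with w Fin.≟ v
  ... | yes _ = just t
  ... | no _ = τ w

  assign-≡ : ∀ τ v t → assign τ v t v ≡ just t
  assign-≡ τ v t with v Fin.≟ v
  ... | yes _ = refl
  ... | no v≢v = ⊥-elim (v≢v refl)

  assign-≢ : ∀ τ v t {w} → w ≢ v → assign τ v t w ≡ τ w
  assign-≢ τ v t {w} w≢v with w Fin.≟ v
  ... | yes w≡v = ⊥-elim (w≢v w≡v)
  ... | no _ = refl

  assign-new : ∀ τ v t {w} → Oriented (assign τ v t) w → τ w ≡ nothing → w ≡ v
  assign-new τ v t {w} (t′ , eq) τw≡nothing with w Fin.≟ v
  ... | yes w≡v = w≡v
  ... | no _ with trans (sym eq) τw≡nothing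
  ...   | ()

  ⊑-assign : ∀ τ v t → τ v ≡ nothing → τ ⊑ assign τ v t
  ⊑-assign τ v t τv≡nothing w t′ eq with w Fin.≟ v
  ... | no _ = eq
  ... | yes refl with trans (sym τv≡nothing) eq
  ...   | ()

  OrientationStep : Orientation → V G → Set
  OrientationStep τ v = Σ Orientation λ τ′ → Witnessed τ′ × τ ⊑ τ′ × Oriented τ′ v

  module _ {τ v z z′} (W : Witnessed τ) (τv≡nothing : τ v ≡ nothing) (exit : ExitEdge v z z′) where

    private
      root≡v : root z ≡ v
      root≡v = proj₂ (proj₁ (proj₂ exit))

      z∉S : z ∉ S
      z∉S = proj₁ (proj₁ (proj₂ exit))

    orient-towards-S : z′ ∈ S → OrientationStep τ v
    orient-towards-S z′∈S = τ′ , witnessed-⊑ W (⊑-assign τ v true τv≡nothing) new , ⊑-assign τ v true τv≡nothing , true , assign-≡ τ v true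
      where
        τ′ = assign τ v true
        new : ∀ w → Oriented τ′ w → τ w ≡ nothing → CrossFrom τ′ w
        new w oriented τw≡nothing with assign-new τ v true oriented τw≡nothing
        ... | refl = z , z′ , root≡v , proj₁ exit , z∉S , true , trans (cong τ′ root≡v) (assign-≡ τ v true) ,
                     inj₁ (z′∈S , exit-target≢parent exit z′∈S)

    orient-against : z′ ∉ S → ∀ t → τ (root z′) ≡ just t → OrientationStep τ v
    orient-against z′∉S t τr′≡t = τ′ , witnessed-⊑ W (⊑-assign τ v (not t) τv≡nothing) new ,
                                  ⊑-assign τ v (not t) τv≡nothing , not t , assign-≡ τ v (not t)
      where
        τ′ = assign τ v (not t)
        new : ∀ w → Oriented τ′ w → τ w ≡ nothing → CrossFrom τ′ w
        new w oriented τw≡nothing with assign-new τ v (not t) oriented τw≡nothing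
        ... | refl = z , z′ , root≡v , proj₁ exit , z∉S , not t , trans (cong τ′ root≡v) (assign-≡ τ v (not t)) ,
                     inj₂ (z′∉S , trans (assign-≢ τ w (not t) (exit-target-root≢ exit z′∉S))
                                        (trans τr′≡t (cong just (sym (not-involutive t)))))

    orient-pair : z′ ∉ S → τ (root z′) ≡ nothing → OrientationStep τ v
    orient-pair z′∉S τr′≡nothing = τ₂ , witnessed-⊑ W τ⊑τ₂ new , τ⊑τ₂ , true , τ₂v≡true
      where
        r′ = root z′
        r′≢v : r′ ≢ v
        r′≢v = exit-target-root≢ exit z′∉S
        τ₁ = assign τ v true
        τ₂ = assign τ₁ r′ false
        τ⊑τ₂ : τ ⊑ τ₂
        τ⊑τ₂ = ⊑-trans (⊑-assign τ v true τv≡nothing) (⊑-assign τ₁ r′ false (trans (assign-≢ τ v true r′≢v) τr′≡nothing))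
        τ₂v≡true : τ₂ v ≡ just true
        τ₂v≡true = trans (assign-≢ τ₁ r′ false (λ v≡r′ → r′≢v (sym v≡r′))) (assign-≡ τ v true)
        τ₂r′≡false : τ₂ r′ ≡ just false
        τ₂r′≡false = assign-≡ τ₁ r′ false
        new : ∀ w → Oriented τ₂ w → τ w ≡ nothing → CrossFrom τ₂ w
        new w oriented τw≡nothing with w Fin.≟ v
        ... | yes refl = z , z′ , root≡v , proj₁ exit , z∉S , true , trans (cong τ₂ root≡v) τ₂v≡true , inj₂ (z′∉S , τ₂r′≡false)
        ... | no w≢v with assign-new τ₁ r′ false {w} oriented (trans (assign-≢ τ v true w≢v) τw≡nothing)
        ...   | refl = z′ , z , refl , E-sym G (proj₁ exit) , z′∉S , false , τ₂r′≡false ,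
                       inj₂ (z∉S , trans (cong τ₂ root≡v) τ₂v≡true)

    orient-along-exit : OrientationStep τ v
    orient-along-exit with z′ ∈? S
    ... | yes z′∈S = orient-towards-S z′∈S
    ... | no z′∉S with τ (root z′) in eq
    ...   | just t = orient-against z′∉S t eq
    ...   | nothing = orient-pair z′∉S eq

  orient-root : ∀ {τ} → Witnessed τ → ∀ v →
                Σ Orientation λ τ′ → Witnessed τ′ × τ ⊑ τ′ × (HasExit v → Oriented τ′ v)
  orient-root {τ} W v with τ v in eq | hasExit? v
  ... | just t | _ = τ , W , ⊑-refl , λ _ → t , eq
  ... | nothing | no no-exit = τ , W , ⊑-refl , λ exit → ⊥-elim (no-exit exit)
  ... | nothing | yes (z , z′ , exit) = let (τ′ , W′ , τ⊑τ′ , oriented) = orient-along-exit W eq exit in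
                                         τ′ , W′ , τ⊑τ′ , λ _ → oriented

  orient-roots : ∀ {τ} → Witnessed τ → (vs : List (V G)) →
                 Σ Orientation λ τ′ → Witnessed τ′ × τ ⊑ τ′ × (∀ v → v List.∈ vs → HasExit v → Oriented τ′ v)
  orient-roots W [] = _ , W , ⊑-refl , λ _ ()
  orient-roots W (v ∷ vs) with orient-root W v
  ... | τ₁ , W₁ , τ⊑τ₁ , oriented₁ with orient-roots W₁ vs
  ...   | τ₂ , W₂ , τ₁⊑τ₂ , oriented₂ = τ₂ , W₂ , ⊑-trans τ⊑τ₁ τ₁⊑τ₂ , oriented
    where
      oriented : ∀ w → w List.∈ (v ∷ vs) → HasExit w → Oriented τ₂ w
      oriented w (here refl) exit = let (t , eq) = oriented₁ exit in t , τ₁⊑τ₂ w t eq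
      oriented w (there w∈vs) exit = oriented₂ w w∈vs exit

  private
    orientation-spec : Σ Orientation λ τ → Witnessed τ × (λ _ → nothing) ⊑ τ × (∀ v → v List.∈ allFin (n G) → HasExit v → Oriented τ v)
    orientation-spec = orient-roots (λ { _ (_ , ()) }) (allFin (n G))

  orientation : Orientation
  orientation = proj₁ orientation-spec

  orientation-witnessed : Witnessed orientation
  orientation-witnessed = proj₁ (proj₂ orientation-spec)

  exit⇒oriented : ∀ {v} → HasExit v → Oriented orientation v
  exit⇒oriented {v} = proj₂ (proj₂ (proj₂ orientation-spec)) v (List.∈-allFin v)

  private
    opposite⇒≢ : ∀ {τ : Orientation} {a b t} → τ a ≡ just t → τ b ≡ just (not t) → a ≢ b
    opposite⇒≢ {t = t} τa τb refl = t≢not t (Maybe.just-injective (trans (sym τa) τb))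
      where
        t≢not : ∀ t → t ≢ not t
        t≢not true ()
        t≢not false ()

  parent∉S⇒1<level : ∀ {y} → parent y ∉ S → 1 < level y
  parent∉S⇒1<level {y} p∉S = subst (1 <_) (proj₂ (parent-spec y∉S)) (s≤s (∉S⇒level>0 p∉S))
    where
      y∉S : y ∉ S
      y∉S y∈S = p∉S (subst (_∈ S) (sym (parent-∈S y∈S)) y∈S)

  CrossEdge⇒ExitEdge : ∀ {τ z z′} → CrossEdge τ z z′ → ExitEdge (root z) z z′
  CrossEdge⇒ExitEdge {τ} {z} {z′} (e , z∉S , t , τr , far) = e , (z∉S , refl) , outside far , not-tree far
    where
      outside : (z′ ∈ S × z′ ≢ parent z) ⊎ (z′ ∉ S × τ (root z′) ≡ just (not t)) → OutsideSubtree (root z) z′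
      outside (inj₁ (z′∈S , _)) = inj₁ z′∈S
      outside (inj₂ (_ , τr′)) = inj₂ (λ eq → opposite⇒≢ {τ} τr τr′ (sym eq))
      not-tree : (z′ ∈ S × z′ ≢ parent z) ⊎ (z′ ∉ S × τ (root z′) ≡ just (not t)) → ¬ (z ≡ root z × z′ ≡ parent (root z))
      not-tree (inj₁ (_ , z′≢p)) (z≡r , z′≡p) = z′≢p (trans z′≡p (cong parent (sym z≡r)))
      not-tree (inj₂ (z′∉S , _)) (_ , z′≡p) = z′∉S (subst (_∈ S) (sym z′≡p) (level≡1⇒parent∈S (level-root z∉S)))

  CrossEdge-sym : ∀ {τ z z′} → CrossEdge τ z z′ → z′ ∉ S → CrossEdge τ z′ z
  CrossEdge-sym (_ , _ , _ , _ , inj₁ (z′∈S , _)) z′∉S = ⊥-elim (z′∉S z′∈S)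
  CrossEdge-sym (e , z∉S , t , τr , inj₂ (z′∉S , τr′)) _ =
    E-sym G e , z′∉S , not t , τr′ , inj₂ (z∉S , trans τr (cong just (sym (not-involutive t))))

  CrossEdge⇒≢parent : ∀ {τ z z′} → CrossEdge τ z z′ → z′ ≢ parent z
  CrossEdge⇒≢parent (_ , _ , _ , _ , inj₁ (_ , z′≢p)) = z′≢p
  CrossEdge⇒≢parent {τ} {z} (_ , _ , _ , τr , inj₂ (z′∉S , τr′)) z′≡p =
    opposite⇒≢ {τ} τr τr′ (trans (sym (root-parent z (parent∉S⇒1<level (subst (_∉ S) z′≡p z′∉S)))) (cong root (sym z′≡p)))

  CrossEdge⇒≢child : ∀ {τ z z′} → CrossEdge τ z z′ → z ≢ parent z′
  CrossEdge⇒≢child (e , _ , _ , _ , inj₁ (z′∈S , _)) z≡p = E⇒≢ G e (trans z≡p (parent-∈S z′∈S))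
  CrossEdge⇒≢child {τ} {z} {z′} (_ , z∉S , _ , τr , inj₂ (_ , τr′)) z≡p =
    opposite⇒≢ {τ} τr τr′ (trans (cong root z≡p) (root-parent z′ (parent∉S⇒1<level (subst (_∉ S) z≡p z∉S))))

  IsAncestor : V G → V G → Set
  IsAncestor z w = ∃ λ j → j < suc (level z) × ancestor j z ≡ w

  InExtended : V G → Set
  InExtended w = w ∈ S ⊎ BridgeRoot w ⊎ ∃₂ λ z z′ → CrossEdge orientation z z′ × IsAncestor z w

  inExtended? : Decidable InExtended
  inExtended? w = (w ∈? S) ⊎-dec (bridgeRoot? w ⊎-dec Fin.any? (λ z → Fin.any? (λ z′ →
                  crossEdge? orientation z z′ ×-dec anyUpTo? (λ j → ancestor j z Fin.≟ w) (suc (level z)))))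

  Extended : Subset (n G)
  Extended = fromDecidable inExtended?

  S⊆Extended : S ⊆ Extended
  S⊆Extended w∈S = ∈-fromDecidable⁺ inExtended? (inj₁ w∈S)

  cross⇒ancestor∈Extended : ∀ {z z′ j} → CrossEdge orientation z z′ → j ≤ level z → ancestor j z ∈ Extended
  cross⇒ancestor∈Extended {z} {z′} {j} cross j≤level = ∈-fromDecidable⁺ inExtended? (inj₂ (inj₂ (z , z′ , cross , j , s≤s j≤level , refl)))

  Extended-parent-closed : ∀ {w} → w ∈ Extended → parent w ∈ Extended
  Extended-parent-closed {w} w∈ with ∈-fromDecidable⁻ inExtended? w∈
  ... | inj₁ w∈S = S⊆Extended (subst (_∈ S) (sym (parent-∈S w∈S)) w∈S)
  ... | inj₂ (inj₁ (level≡1 , _)) = S⊆Extended (level≡1⇒parent∈S level≡1)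
  ... | inj₂ (inj₂ (z , z′ , cross , j , s≤s j≤level , refl)) with m≤n⇒m<n∨m≡n j≤level
  ...   | inj₁ j<level = subst (_∈ Extended) (ancestor-suc j z) (cross⇒ancestor∈Extended cross j<level)
  ...   | inj₂ refl = S⊆Extended (subst (_∈ S) (sym (parent-∈S (ancestor-level-∈S z))) (ancestor-level-∈S z))

  level1⊆Extended : ∀ {v} → level v ≡ 1 → v ∈ Extended
  level1⊆Extended {v} level≡1 with hasExit? v
  ... | no no-exit = ∈-fromDecidable⁺ inExtended? (inj₂ (inj₁ (level≡1 , no-exit)))
  ... | yes exit with orientation-witnessed v (exit⇒oriented exit)
  ...   | z , z′ , refl , cross = cross⇒ancestor∈Extended cross (m∸n≤m (level z) 1)

  Extended-dominating : StepDominating G (k ∸ 1) Extended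
  Extended-dominating v with dom v
  ... | s , s∈S , 0 , _ , nil _ = s , S⊆Extended s∈S , 0 , z≤n , nil s
  ... | s , s∈S , suc l , l<k , cons {y = x} e walk = x , x∈Extended , l , ∸-monoˡ-≤ 1 l<k , walk
    where
      x∈Extended : x ∈ Extended
      x∈Extended with x ∈? S
      ... | yes x∈S = S⊆Extended x∈S
      ... | no x∉S = level1⊆Extended (neighbour⇒level≡1 s∈S x∉S e)

2≤m∸n : ∀ m n → n < m ∸ 1 → 2 ≤ m ∸ n
2≤m∸n (suc (suc m)) zero _ = s≤s (s≤s z≤n)
2≤m∸n (suc m) (suc n) n<m = 2≤m∸n m n (∸-monoˡ-≤ 1 n<m)

module _ {m : ℕ} where

  orderedPair : Fin m → Fin m → Fin m × Fin m
  orderedPair x y with toℕ x <? toℕ y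
  ... | yes _ = x , y
  ... | no _ = y , x

  orderedPair-spec : ∀ {x y} → x ≢ y → (toℕ x < toℕ y × orderedPair x y ≡ (x , y)) ⊎ (toℕ y < toℕ x × orderedPair x y ≡ (y , x))
  orderedPair-spec {x} {y} x≢y with toℕ x <? toℕ y
  ... | yes x<y = inj₁ (x<y , refl)
  ... | no x≮y = inj₂ (≤∧≢⇒< (≮⇒≥ x≮y) (λ eq → x≢y (sym (Fin.toℕ-injective eq))) , refl)

  orderedPair-injective : ∀ {x y x′ y′} → orderedPair x y ≡ orderedPair x′ y′ → (x ≡ x′ × y ≡ y′) ⊎ (x ≡ y′ × y ≡ x′)
  orderedPair-injective {x} {y} {x′} {y′} eq with toℕ x <? toℕ y | toℕ x′ <? toℕ y′ | eq
  ... | yes _ | yes _ | refl = inj₁ (refl , refl)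
  ... | yes _ | no _ | refl = inj₂ (refl , refl)
  ... | no _ | yes _ | refl = inj₂ (refl , refl)
  ... | no _ | no _ | refl = inj₁ (refl , refl)

module Bridges (G : Graph) (conn : Connected G) (S : Subset (n G)) (S-connected : ConnectedSet G S)
               (k : ℕ) (dom : StepDominating G k S) where

  open Subtrees G S k dom public
  open DecMembership (Product.≡-dec (Fin._≟_ {n G}) (Fin._≟_ {n G})) using () renaming (_∈?_ to _∈ᴸ?_)

  private
    S-walk : ∀ {x y} → x ∈ S → y ∈ S → ∃ (Walk (InducedAdj G S) x y)
    S-walk {x} {y} x∈S y∈S = S-connected x y x∈S y∈S

    avoiding-S : ∀ {a b x y l} → b ∉ S → Walk (InducedAdj G S) x y l → Walk (DelAdj G a b) x y l
    avoiding-S b∉S = mapʷ λ { (e , x∈S , y∈S) → e , λ { (inj₁ (_ , refl)) → b∉S y∈S ; (inj₂ (refl , _)) → b∉S x∈S } }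

    climb-avoiding : ∀ {v} → level v ≡ 1 → ∀ m z → (∀ i → i < m → ancestor i z ∉ S × ancestor i z ≢ v) →
                     Walk (DelAdj G (parent v) v) z (ancestor m z) m
    climb-avoiding {v} level≡1 m z off-edge = ancestorWalk m z λ i i<m →
      let (y∉S , y≢v) = off-edge i i<m in
      parent-edge y∉S , λ { (inj₁ (y≡p , _)) → y∉S (subst (_∈ S) (sym y≡p) (level≡1⇒parent∈S level≡1))
                          ; (inj₂ (y≡v , _)) → y≢v y≡v }

  bridgeRoot⇒IsBridge : ∀ {v} → BridgeRoot v → IsBridge G (parent v) v
  -- without the tree edge, walks from v stay inside its subtree, which misses parent v ∈ S
  bridgeRoot⇒IsBridge {v} (level≡1 , no-exit) = proj₁ (parent-spec v∉S) , λ connected →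
    proj₁ (stays (v∉S , root-of-level1 level≡1) (proj₂ (connected v (parent v)))) (level≡1⇒parent∈S level≡1)
    where
      v∉S = level≡1⇒∉S level≡1
      stays : ∀ {x y l} → InSubtree v x → Walk (DelAdj G (parent v) v) x y l → InSubtree v y
      stays inside (nil _) = inside
      stays inside (cons {x} {y} (e , not-tree) w) with ¬? (y ∈? S) ×-dec (root y Fin.≟ v)
      ... | yes y-inside = stays y-inside w
      ... | no y-outside = ⊥-elim (no-exit (x , y , e , inside , outside , λ (p , q) → not-tree (inj₂ (p , q))))
        where
          outside : OutsideSubtree v y
          outside with y ∈? S
          ... | yes y∈S = inj₁ y∈S
          ... | no y∉S = inj₂ λ root≡v → y-outside (y∉S , root≡v)

  -- the detour runs from v down to z, across the exit edge, and up to S and parent v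
  exit⇒¬IsBridge : ∀ {v} → HasExit v → ¬ IsBridge G (parent v) v
  exit⇒¬IsBridge {v} (z , z′ , exit@(e , (z∉S , refl) , outside , not-tree)) =
    detour⇒¬IsBridge G conn (reverseʷ (DelAdj-sym G) down ++ʷ cons cross (proj₂ up))
    where
      level≡1 = exit⇒level≡1 exit
      p∈S = level≡1⇒parent∈S level≡1
      down : Walk (DelAdj G (parent v) v) z v (level z ∸ 1)
      down = climb-avoiding level≡1 (level z ∸ 1) z λ i i<l → let 2≤ = level≥2 i i<l in
        level>0⇒∉S (≤-trans (s≤s z≤n) 2≤) , λ eq → <-irrefl refl (≤-trans 2≤ (≤-reflexive (trans (cong level eq) level≡1)))
        where
          level≥2 : ∀ i → i < level z ∸ 1 → 2 ≤ level (ancestor i z)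
          level≥2 i i<l rewrite level-ancestor i z = 2≤m∸n (level z) i i<l
      cross : DelAdj G (parent v) v z z′
      cross = e , λ { (inj₁ (z≡p , _)) → z∉S (subst (_∈ S) (sym z≡p) p∈S) ; (inj₂ (z≡v , z′≡p)) → not-tree (z≡v , z′≡p) }
      up : ∃ (Walk (DelAdj G (parent v) v) z′ (parent v))
      up with z′ ∈? S
      ... | yes z′∈S = _ , avoiding-S (level≡1⇒∉S level≡1) (proj₂ (S-walk z′∈S p∈S))
      ... | no z′∉S = _ , (climb-avoiding level≡1 (level z′) z′ off-edge
                           ++ʷ avoiding-S (level≡1⇒∉S level≡1) (proj₂ (S-walk (ancestor-level-∈S z′) p∈S)))
        where
          off-edge : ∀ i → i < level z′ → ancestor i z′ ∉ S × ancestor i z′ ≢ v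
          off-edge i i<l = ancestor-∉S i<l , λ eq → outside-root outside (trans (sym (root-ancestor i z′ i<l)) (trans (cong root eq) (root-of-level1 level≡1)))
            where
              outside-root : OutsideSubtree v z′ → root z′ ≢ v
              outside-root (inj₁ z′∈S) = ⊥-elim (z′∉S z′∈S)
              outside-root (inj₂ ne) = ne

  nontree⇒¬IsBridge : ∀ {s v} → s ∈ S → v ∉ S → E G s v → s ≢ parent v → ¬ IsBridge G s v
  nontree⇒¬IsBridge {s} {v} s∈S v∉S e s≢p = detour⇒¬IsBridge G conn
    (cons (parent-edge v∉S , not-sv) (avoiding-S v∉S (proj₂ (S-walk (level≡1⇒parent∈S (neighbour⇒level≡1 s∈S v∉S e)) s∈S))))
    where
      not-sv : ¬ ((v ≡ s × parent v ≡ v) ⊎ (v ≡ v × parent v ≡ s))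
      not-sv (inj₁ (v≡s , _)) = v∉S (subst (_∈ S) (sym v≡s) s∈S)
      not-sv (inj₂ (_ , p≡s)) = s≢p (sym p≡s)

  isBridge? : ∀ {s v} → s ∈ S → v ∉ S → E G s v → Dec (IsBridge G s v)
  isBridge? {s} {v} s∈S v∉S e with s Fin.≟ parent v
  ... | no s≢p = no (nontree⇒¬IsBridge s∈S v∉S e s≢p)
  ... | yes refl with hasExit? v
  ...   | yes exit = no (exit⇒¬IsBridge exit)
  ...   | no no-exit = yes (bridgeRoot⇒IsBridge (neighbour⇒level≡1 s∈S v∉S e , no-exit))

  inN? : ∀ v → Dec (InN G S v)
  inN? v = ¬? (v ∈? S) ×-dec Fin.any? (λ s → s ∈? S ×-dec E? G s v)

  bridgeIn? : Decidable (BridgeIn G S)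
  bridgeIn? (x , y) with toℕ x <? toℕ y | (x ∈? S ×-dec inN? y) ⊎-dec (y ∈? S ×-dec inN? x) | E? G x y
  ... | no x≮y | _ | _ = no λ b → x≮y (proj₁ b)
  ... | yes _ | no not-across | _ = no λ b → not-across (proj₂ (proj₂ b))
  ... | yes _ | yes _ | no ¬e = no λ b → ¬e (proj₁ (proj₁ (proj₂ b)))
  ... | yes x<y | yes across@(inj₁ (x∈S , y∉S , _)) | yes e with isBridge? x∈S y∉S e
  ...   | yes bridge = yes (x<y , bridge , across)
  ...   | no ¬bridge = no λ b → ¬bridge (proj₁ (proj₂ b))
  bridgeIn? (x , y) | yes x<y | yes across@(inj₂ (y∈S , x∉S , _)) | yes e with isBridge? y∈S x∉S (E-sym G e)
  ...   | yes bridge = yes (x<y , IsBridge-sym G bridge , across)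
  ...   | no ¬bridge = no λ b → ¬bridge (IsBridge-sym G (proj₁ (proj₂ b)))

  bridges : List (V G × V G)
  bridges = filter bridgeIn? (cartesianProduct (allFin (n G)) (allFin (n G)))

  bridgeCount : ℕ
  bridgeCount = length bridges

  bridgeCount-spec : CountIs (BridgeIn G S) bridgeCount
  bridgeCount-spec = bridges , Unique.filter⁺ bridgeIn? (Unique.cartesianProduct⁺ (Unique.allFin⁺ _) (Unique.allFin⁺ _)) ,
    (λ p → mk⇔ (λ p∈ → proj₂ (List.∈-filter⁻ bridgeIn? {xs = cartesianProduct (allFin (n G)) (allFin (n G))} p∈))
               (List.∈-filter⁺ bridgeIn? (List.∈-cartesianProduct⁺ (List.∈-allFin _) (List.∈-allFin _)))) ,
    refl

  bridgeIndex : V G → ℕ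
  bridgeIndex v with orderedPair (parent v) v ∈ᴸ? bridges
  ... | yes p = toℕ (Any.index p)
  ... | no _ = 0

  private
    parent≢ : ∀ {v} → level v ≡ 1 → parent v ≢ v
    parent≢ level≡1 p≡v = level≡1⇒∉S level≡1 (subst (_∈ S) p≡v (level≡1⇒parent∈S level≡1))

    bridgeRoot∈bridges : ∀ {v} → BridgeRoot v → orderedPair (parent v) v List.∈ bridges
    bridgeRoot∈bridges {v} br@(level≡1 , _) = List.∈-filter⁺ bridgeIn? (List.∈-cartesianProduct⁺ (List.∈-allFin _) (List.∈-allFin _)) bridgeIn
      where
        across = level≡1⇒parent∈S level≡1 , level≡1⇒∉S level≡1 , parent v , level≡1⇒parent∈S level≡1 , proj₁ (parent-spec (level≡1⇒∉S level≡1))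
        bridgeIn : BridgeIn G S (orderedPair (parent v) v)
        bridgeIn with orderedPair-spec (parent≢ level≡1)
        ... | inj₁ (p<v , eq) rewrite eq = p<v , bridgeRoot⇒IsBridge br , inj₁ across
        ... | inj₂ (v<p , eq) rewrite eq = v<p , IsBridge-sym G (bridgeRoot⇒IsBridge br) , inj₂ across

    bridgeIndex-spec : ∀ {v} → BridgeRoot v → ∃ λ (p : orderedPair (parent v) v List.∈ bridges) → bridgeIndex v ≡ toℕ (Any.index p)
    bridgeIndex-spec {v} br with orderedPair (parent v) v ∈ᴸ? bridges
    ... | yes p = p , refl
    ... | no p∉ = ⊥-elim (p∉ (bridgeRoot∈bridges br))

  bridgeIndex<bridgeCount : ∀ {v} → BridgeRoot v → bridgeIndex v < bridgeCount
  bridgeIndex<bridgeCount br = let (p , eq) = bridgeIndex-spec br in subst (_< bridgeCount) (sym eq) (Fin.toℕ<n (Any.index p))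

  bridgeIndex-injective : ∀ {v v′} → BridgeRoot v → BridgeRoot v′ → bridgeIndex v ≡ bridgeIndex v′ → v ≡ v′
  bridgeIndex-injective {v} {v′} br br′ eq with bridgeIndex-spec br | bridgeIndex-spec br′
  ... | p , eq₁ | p′ , eq₂ with orderedPair-injective same-pair
    where
      same-pair : orderedPair (parent v) v ≡ orderedPair (parent v′) v′
      same-pair = trans (Any.lookup-index p)
                        (trans (cong (lookup bridges) (Fin.toℕ-injective (trans (sym eq₁) (trans eq eq₂)))) (sym (Any.lookup-index p′)))
  ... | inj₁ (_ , v≡v′) = v≡v′
  ... | inj₂ (p≡v′ , _) = ⊥-elim (level≡1⇒∉S (proj₁ br′) (subst (_∈ S) p≡v′ (level≡1⇒parent∈S (proj₁ br))))

module Recolouring (G : Graph) (conn : Connected G) (S : Subset (n G)) (k : ℕ) (dom : StepDominating G k S)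
                   (q : ℕ) (c : V G → V G → ℕ) (c-sym : ∀ x y → c x y ≡ c y x) (rainbow : RainbowIn G S q c) where

  open Bridges G conn S (RainbowIn⇒ConnectedSet {G} {S} {q} {c} rainbow) k dom public

  K : ℕ
  K = 2 * k + 1

  M : ℕ
  M = K ⊔ bridgeCount

  -- levels 1 … k of a subtree of orientation t get the colours 0 … k−1 (t = true) or 2k … k+1 (t = false)
  sideColour : Bool → ℕ → ℕ
  sideColour true l = l ∸ 1
  sideColour false l = K ∸ l

  -- the last case does not occur: a subtree that does not hang from a bridge has an exit, hence is oriented
  treeColour : V G → ℕ
  treeColour y with bridgeRoot? (root y)
  ... | yes _ = bridgeIndex (root y)
  ... | no _ with orientation (root y)
  ...   | just t = sideColour t (level y)
  ...   | nothing = 0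

  TreeEdge : V G → V G → Set
  TreeEdge x y = x ∉ S × y ≡ parent x

  CrossingEdge : V G → V G → Set
  CrossingEdge x y = CrossEdge orientation x y ⊎ CrossEdge orientation y x

  treeEdge? : ∀ x y → Dec (TreeEdge x y)
  treeEdge? x y = ¬? (x ∈? S) ×-dec (y Fin.≟ parent x)

  crossingEdge? : ∀ x y → Dec (CrossingEdge x y)
  crossingEdge? x y = crossEdge? orientation x y ⊎-dec crossEdge? orientation y x

  -- the remaining edges are used by no rainbow walk and get the junk colour 0
  colour′ : V G → V G → ℕ
  colour′ x y = by-kind (x ∈? S ×-dec y ∈? S) (treeEdge? x y) (treeEdge? y x) (crossingEdge? x y)
    where
      by-kind : Dec (x ∈ S × y ∈ S) → Dec (TreeEdge x y) → Dec (TreeEdge y x) → Dec (CrossingEdge x y) → ℕ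
      by-kind (yes _) _ _ _ = c x y
      by-kind (no _) (yes _) _ _ = q + treeColour x
      by-kind (no _) (no _) (yes _) _ = q + treeColour y
      by-kind (no _) (no _) (no _) (yes _) = q + k
      by-kind (no _) (no _) (no _) (no _) = 0

  private
    TreeEdge-antisym : ∀ {x y} → TreeEdge x y → ¬ TreeEdge y x
    TreeEdge-antisym {x} {y} (x∉S , y≡p) (_ , x≡p) = ≢parent∘parent x∉S (trans x≡p (cong parent y≡p))

  colour′-S : ∀ {x y} → x ∈ S → y ∈ S → colour′ x y ≡ c x y
  colour′-S {x} {y} x∈S y∈S with x ∈? S ×-dec y ∈? S
  ... | yes _ = refl
  ... | no ¬both = ⊥-elim (¬both (x∈S , y∈S))

  colour′-tree : ∀ {x} → x ∉ S → colour′ x (parent x) ≡ q + treeColour x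
  colour′-tree {x} x∉S with x ∈? S ×-dec parent x ∈? S | treeEdge? x (parent x)
  ... | yes (x∈S , _) | _ = ⊥-elim (x∉S x∈S)
  ... | no _ | yes _ = refl
  ... | no _ | no ¬tree = ⊥-elim (¬tree (x∉S , refl))

  colour′-cross : ∀ {z z′} → CrossEdge orientation z z′ → colour′ z z′ ≡ q + k
  colour′-cross {z} {z′} cross@(_ , z∉S , _) with z ∈? S ×-dec z′ ∈? S | treeEdge? z z′ | treeEdge? z′ z | crossingEdge? z z′
  ... | yes (z∈S , _) | _ | _ | _ = ⊥-elim (z∉S z∈S)
  ... | no _ | yes (_ , z′≡p) | _ | _ = ⊥-elim (CrossEdge⇒≢parent {orientation} cross z′≡p)
  ... | no _ | no _ | yes (_ , z≡p) | _ = ⊥-elim (CrossEdge⇒≢child {orientation} cross z≡p)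
  ... | no _ | no _ | no _ | yes _ = refl
  ... | no _ | no _ | no _ | no ¬cross = ⊥-elim (¬cross (inj₁ cross))

  colour′-sym : ∀ x y → colour′ x y ≡ colour′ y x
  colour′-sym x y with x ∈? S ×-dec y ∈? S | y ∈? S ×-dec x ∈? S | treeEdge? x y | treeEdge? y x
                     | crossingEdge? x y | crossingEdge? y x
  ... | yes _ | yes _ | _ | _ | _ | _ = c-sym x y
  ... | yes (x∈S , y∈S) | no ¬both | _ | _ | _ | _ = ⊥-elim (¬both (y∈S , x∈S))
  ... | no ¬both | yes (y∈S , x∈S) | _ | _ | _ | _ = ⊥-elim (¬both (x∈S , y∈S))
  ... | no _ | no _ | yes xy | yes yx | _ | _ = ⊥-elim (TreeEdge-antisym xy yx)
  ... | no _ | no _ | yes _ | no _ | _ | _ = refl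
  ... | no _ | no _ | no _ | yes _ | _ | _ = refl
  ... | no _ | no _ | no _ | no _ | yes _ | yes _ = refl
  ... | no _ | no _ | no _ | no _ | no _ | no _ = refl
  ... | no _ | no _ | no _ | no _ | yes xy | no ¬yx = ⊥-elim (¬yx (Sum.swap xy))
  ... | no _ | no _ | no _ | no _ | no ¬xy | yes yx = ⊥-elim (¬xy (Sum.swap yx))

  treeColour-bridgeRoot : ∀ {v} → BridgeRoot v → treeColour v ≡ bridgeIndex v
  treeColour-bridgeRoot {v} br@(level≡1 , _) with bridgeRoot? (root v)
  ... | yes _ = cong bridgeIndex (root-of-level1 level≡1)
  ... | no ¬root = ⊥-elim (¬root (subst BridgeRoot (sym (root-of-level1 level≡1)) br))

  treeColour-oriented : ∀ {y t} → orientation (root y) ≡ just t → ¬ BridgeRoot (root y) → treeColour y ≡ sideColour t (level y)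
  treeColour-oriented {y} oriented ¬root with bridgeRoot? (root y)
  ... | yes br = ⊥-elim (¬root br)
  ... | no _ rewrite oriented = refl

  -- the colours of levels lo+1 … hi of a subtree with orientation t lie in [sideLow t lo hi, sideHigh t lo hi)
  sideLow : Bool → ℕ → ℕ → ℕ
  sideLow true lo hi = lo
  sideLow false lo hi = K ∸ hi

  sideHigh : Bool → ℕ → ℕ → ℕ
  sideHigh true lo hi = hi
  sideHigh false lo hi = K ∸ lo

  sideColour-InRange : ∀ t {lo hi l} → lo < l → l ≤ hi → hi ≤ K → InRange (sideLow t lo hi) (sideHigh t lo hi) (sideColour t l)
  sideColour-InRange true {l = l} lo<l l≤hi _ = ∸-monoˡ-≤ 1 lo<l , <-≤-trans (≤-reflexive (suc-∸1 (≤-trans (s≤s z≤n) lo<l))) l≤hi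
  sideColour-InRange false lo<l l≤hi hi≤K = ∸-monoʳ-≤ K l≤hi , ∸-monoʳ-< lo<l (≤-trans l≤hi hi≤K)

  sideColour-injective : ∀ t {l l′} → 0 < l → 0 < l′ → l ≤ K → l′ ≤ K → sideColour t l ≡ sideColour t l′ → l ≡ l′
  sideColour-injective true 0<l 0<l′ _ _ eq = trans (sym (suc-∸1 0<l)) (trans (cong suc eq) (suc-∸1 0<l′))
  sideColour-injective false _ _ l≤K l′≤K eq = ∸-cancelˡ-≡ l≤K l′≤K eq

  k≤K : k ≤ K
  k≤K = ≤-trans (m≤m+n k (k + 0)) (m≤m+n (2 * k) 1)

  k<K : k < K
  k<K = ≤-trans (s≤s (m≤m+n k (k + 0))) (≤-reflexive (+-comm 1 (2 * k)))

  K∸k≡1+k : K ∸ k ≡ suc k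
  K∸k≡1+k = begin
    (k + (k + 0)) + 1 ∸ k   ≡⟨ cong (_∸ k) (+-assoc k (k + 0) 1) ⟩
    k + ((k + 0) + 1) ∸ k   ≡⟨ m+n∸m≡n k _ ⟩
    (k + 0) + 1             ≡⟨ cong (_+ 1) (+-identityʳ k) ⟩
    k + 1                   ≡⟨ +-comm k 1 ⟩
    suc k                   ∎
    where open ≡-Reasoning

  1+q+k≡q+[K∸k] : suc (q + k) ≡ q + (K ∸ k)
  1+q+k≡q+[K∸k] = trans (sym (+-suc q k)) (cong (q +_) (sym K∸k≡1+k))

  K≤M : K ≤ M
  K≤M = m≤m⊔n K bridgeCount

  InExtendedAdj : V G → V G → Set
  InExtendedAdj = InducedAdj G Extended

  ancestor-∈Extended : ∀ i {z} → z ∈ Extended → ancestor i z ∈ Extended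
  ancestor-∈Extended zero z∈ = z∈
  ancestor-∈Extended (suc i) z∈ = ancestor-∈Extended i (Extended-parent-closed z∈)

  treeWalk : ∀ m z → m ≤ level z → z ∈ Extended → Walk InExtendedAdj z (ancestor m z) m
  treeWalk m z m≤level z∈ = ancestorWalk m z λ i i<m →
    parent-edge (ancestor-∉S (<-≤-trans i<m m≤level)) , ancestor-∈Extended i z∈ , Extended-parent-closed (ancestor-∈Extended i z∈)

  treeWalk-colours : ∀ m z (m≤level : m ≤ level z) (z∈ : z ∈ Extended) {t} → orientation (root z) ≡ just t → ¬ BridgeRoot (root z) →
                     ∀ {lo hi} → lo ≤ level z ∸ m → level z ≤ hi → hi ≤ K →
                     let cs = edgeColours colour′ (treeWalk m z m≤level z∈) in
                     Unique cs × All (InRange (q + sideLow t lo hi) (q + sideHigh t lo hi)) cs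
  treeWalk-colours m z m≤level z∈ {t} oriented ¬root {lo} {hi} lo≤ level≤hi hi≤K
    rewrite edgeColours-ancestorWalk {R = InExtendedAdj} colour′ m z
              (λ i i<m → parent-edge (ancestor-∉S (<-≤-trans i<m m≤level)) , ancestor-∈Extended i z∈ , Extended-parent-closed (ancestor-∈Extended i z∈)) =
    Unique.applyUpTo⁺₁ _ m (λ {i} {j} i<j j<m eq → <-irrefl refl (subst (i <_) (sym (level-index-injective i j (<-trans i<j j<m) j<m eq)) i<j)) ,
    All.applyUpTo⁺₁ _ m λ {i} i<m → subst (InRange _ _) (sym (colour-at i i<m))
      (+-monoʳ-≤ q (proj₁ (range i i<m)) , +-monoʳ-< q (proj₂ (range i i<m)))
    where
      colour-at : ∀ i → i < m → colour′ (ancestor i z) (parent (ancestor i z)) ≡ q + sideColour t (level z ∸ i)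
      colour-at i i<m = trans (colour′-tree (ancestor-∉S i<level)) (cong (q +_) (trans
        (treeColour-oriented (trans (cong orientation (root-ancestor i z i<level)) oriented) (λ r → ¬root (subst BridgeRoot (root-ancestor i z i<level) r)))
        (cong (sideColour t) (level-ancestor i z))))
        where i<level = <-≤-trans i<m m≤level
      range : ∀ i → i < m → InRange (sideLow t lo hi) (sideHigh t lo hi) (sideColour t (level z ∸ i))
      range i i<m = sideColour-InRange t (≤-<-trans lo≤ (∸-monoʳ-< i<m m≤level)) (≤-trans (m∸n≤m (level z) i) level≤hi) hi≤K
      level-index-injective : ∀ i j → i < m → j < m → colour′ (ancestor i z) (parent (ancestor i z)) ≡ colour′ (ancestor j z) (parent (ancestor j z)) → i ≡ j
      level-index-injective i j i<m j<m eq =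
        ∸-cancelˡ-≡ (≤-trans (<⇒≤ i<m) m≤level) (≤-trans (<⇒≤ j<m) m≤level)
          (sideColour-injective t (m<n⇒0<n∸m (<-≤-trans i<m m≤level)) (m<n⇒0<n∸m (<-≤-trans j<m m≤level)) (below-K i) (below-K j)
            (+-cancelˡ-≡ q _ _ (trans (sym (colour-at i i<m)) (trans eq (colour-at j j<m)))))
        where
          below-K : ∀ i → level z ∸ i ≤ K
          below-K i = ≤-trans (m∸n≤m (level z) i) (≤-trans (level≤k z) k≤K)

  Anchor : V G → ℕ → ℕ → Set
  Anchor x lo hi = ∃ λ s → s ∈ S × ∃₂ λ l (w : Walk InExtendedAdj x s l) →
                   Unique (edgeColours colour′ w) × All (InRange (q + lo) (q + hi)) (edgeColours colour′ w)

  anchor-here : ∀ {x lo hi} → x ∈ S → Anchor x lo hi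
  anchor-here {x} x∈S = x , x∈S , 0 , nil x , [] , []

  private
    liftS : ∀ {x y l} → Walk (InducedAdj G S) x y l → Walk InExtendedAdj x y l
    liftS = mapʷ λ (e , x∈S , y∈S) → e , S⊆Extended x∈S , S⊆Extended y∈S

    edgeColours-liftS : ∀ {x y l} (w : Walk (InducedAdj G S) x y l) → edgeColours colour′ (liftS w) ≡ edgeColours c w
    edgeColours-liftS (nil _) = refl
    edgeColours-liftS (cons (e , x∈S , y∈S) w) = cong₂ _∷_ (colour′-S x∈S y∈S) (edgeColours-liftS w)

  -- two anchors with disjoint colour ranges, joined inside S by an old rainbow walk
  join : ∀ {x y lo₁ hi₁ lo₂ hi₂} → Anchor x lo₁ hi₁ → Anchor y lo₂ hi₂ → hi₁ ≤ lo₂ ⊎ hi₂ ≤ lo₁ → hi₁ ≤ M → hi₂ ≤ M →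
         RainbowWalk InExtendedAdj (q + M) colour′ x y
  join {lo₁ = lo₁} {hi₁} {lo₂} {hi₂} (s , s∈S , _ , wx , ux , ax) (s′ , s′∈S , _ , wy , uy , ay) separated hi₁≤M hi₂≤M =
    _ , walk , subst Unique (sym colours) distinct , subst (All (_< q + M)) (sym colours) bounded
    where
      old = rainbow s s′ s∈S s′∈S
      ws = proj₁ (proj₂ old)
      cx = edgeColours colour′ wx
      cs = edgeColours c ws
      cy = reverse (edgeColours colour′ wy)
      walk = wx ++ʷ liftS ws ++ʷ reverseʷ (InducedAdj-sym G) wy
      colours : edgeColours colour′ walk ≡ cx ++ cs ++ cy
      colours = begin
        edgeColours colour′ walk                                                             ≡⟨ edgeColours-++ colour′ wx _ ⟩
        cx ++ edgeColours colour′ (liftS ws ++ʷ reverseʷ (InducedAdj-sym G) wy)               ≡⟨ cong (cx ++_) (edgeColours-++ colour′ (liftS ws) _) ⟩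
        cx ++ edgeColours colour′ (liftS ws) ++ edgeColours colour′ (reverseʷ (InducedAdj-sym G) wy)
          ≡⟨ cong (cx ++_) (cong₂ _++_ (edgeColours-liftS ws) (edgeColours-reverse (InducedAdj-sym G) colour′ colour′-sym wy)) ⟩
        cx ++ cs ++ cy                                                                        ∎
        where open ≡-Reasoning
      as : All (InRange 0 q) cs
      as = All.map (z≤n ,_) (proj₂ (proj₂ (proj₂ old)))
      ay′ : All (InRange (q + lo₂) (q + hi₂)) cy
      ay′ = all-reverse ay
      distinct : Unique (cx ++ cs ++ cy)
      distinct = Unique.++⁺ ux (unique-++-separated (proj₁ (proj₂ (proj₂ old))) as (unique-reverse uy) ay′ (inj₁ (m≤m+n q lo₂)))
        (Disjoint-++ (InRange-disjoint ax as (inj₂ (m≤m+n q lo₁)))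
                     (InRange-disjoint ax ay′ (Sum.map (+-monoʳ-≤ q) (+-monoʳ-≤ q) separated)))
      bounded : All (_< q + M) (cx ++ cs ++ cy)
      bounded = All.++⁺ (All.map (λ r → <-≤-trans (proj₂ r) (+-monoʳ-≤ q hi₁≤M)) ax)
                (All.++⁺ (All.map (λ r → <-≤-trans (proj₂ r) (m≤m+n q M)) as)
                         (All.map (λ r → <-≤-trans (proj₂ r) (+-monoʳ-≤ q hi₂≤M)) ay′))

  -- a walk from level l of a subtree of orientation t through a cross edge (colour k) into the opposite subtree
  -- has its colours in [throughLow t l, throughHigh t l)
  throughLow : Bool → ℕ → ℕ
  throughLow true l = l
  throughLow false l = 0

  throughHigh : Bool → ℕ → ℕ
  throughHigh true l = K
  throughHigh false l = K ∸ l

  through-colours : ∀ t {l xs ys} → l ≤ k → Unique xs → All (InRange (q + sideLow t l k) (q + sideHigh t l k)) xs →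
                    Unique ys → All (InRange (q + sideLow (not t) 0 k) (q + sideHigh (not t) 0 k)) ys →
                    Unique (xs ++ (q + k) ∷ ys) × All (InRange (q + throughLow t l) (q + throughHigh t l)) (xs ++ (q + k) ∷ ys)
  through-colours true l≤k uxs xs∈ uys ys∈ =
    unique-around (+-monoʳ-≤ q l≤k) (+-monoʳ-< q k<K) uxs uys (inj₁ (xs∈ , InRange-weaken (≤-reflexive 1+q+k≡q+[K∸k]) ≤-refl ys∈))
  through-colours false {l} l≤k uxs xs∈ uys ys∈ =
    unique-around (+-monoʳ-≤ q z≤n) (+-monoʳ-< q k<K∸l) uxs uys (inj₂ (InRange-weaken (≤-reflexive 1+q+k≡q+[K∸k]) ≤-refl xs∈ , ys∈))
    where
      k<K∸l : k < K ∸ l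
      k<K∸l = ≤-trans (≤-reflexive (sym K∸k≡1+k)) (∸-monoʳ-≤ K l≤k)

  data Anchors (x : V G) : Set where
    split  : ∀ s → s ≤ M → Anchor x 0 s → Anchor x s M → Anchors x
    bridge : BridgeRoot x → Anchor x (treeColour x) (suc (treeColour x)) → Anchors x

  bridgeAnchors : ∀ {x} → x ∈ Extended → BridgeRoot x → Anchors x
  bridgeAnchors {x} x∈ br@(level≡1 , _) = bridge br (parent x , level≡1⇒parent∈S level≡1 , 1 ,
    cons (parent-edge x∉S , x∈ , Extended-parent-closed x∈) (nil _) ,
    [] ∷ [] , subst (InRange (q + treeColour x) (q + suc (treeColour x))) (sym (colour′-tree x∉S)) (≤-refl , +-monoʳ-< q ≤-refl) ∷ [])
    where x∉S = level≡1⇒∉S level≡1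

  Anchor-weaken : ∀ {x lo hi lo′ hi′} → lo′ ≤ lo → hi ≤ hi′ → Anchor x lo hi → Anchor x lo′ hi′
  Anchor-weaken lo′≤lo hi≤hi′ (s , s∈S , l , w , distinct , range) =
    s , s∈S , l , w , distinct , InRange-weaken (+-monoʳ-≤ q lo′≤lo) (+-monoʳ-≤ q hi≤hi′) range

  module CrossEdgeAnchors {z z′ : V G} (e : E G z z′) (z∉S : z ∉ S) (t : Bool) (oriented : orientation (root z) ≡ just t)
           (far : (z′ ∈ S × z′ ≢ parent z) ⊎ (z′ ∉ S × orientation (root z′) ≡ just (not t)))
           {j : ℕ} (j≤level : j ≤ level z) (w∉S : ancestor j z ∉ S) where

    private
      cross : CrossEdge orientation z z′
      cross = e , z∉S , t , oriented , far

      w = ancestor j z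

      j<level : j < level z
      j<level = ≤∧≢⇒< j≤level λ j≡level → w∉S (subst (λ i → ancestor i z ∈ S) (sym j≡level) (ancestor-level-∈S z))

      ¬root : ¬ BridgeRoot (root z)
      ¬root (_ , no-exit) = no-exit (z , z′ , CrossEdge⇒ExitEdge {orientation} cross)

      z∈ : z ∈ Extended
      z∈ = cross⇒ancestor∈Extended cross z≤n

      w∈ : w ∈ Extended
      w∈ = cross⇒ancestor∈Extended cross j≤level

      root-w : root w ≡ root z
      root-w = root-ancestor j z j<level

      z′-anchor : Anchor z′ (sideLow (not t) 0 k) (sideHigh (not t) 0 k)
      z′∈ : z′ ∈ Extended
      z′∈ = from far
        where
          from : (z′ ∈ S × z′ ≢ parent z) ⊎ (z′ ∉ S × orientation (root z′) ≡ just (not t)) → z′ ∈ Extended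
          from (inj₁ (z′∈S , _)) = S⊆Extended z′∈S
          from (inj₂ (z′∉S , _)) = cross⇒ancestor∈Extended (CrossEdge-sym {orientation} cross z′∉S) z≤n

      z′-anchor = from far
        where
          from : (z′ ∈ S × z′ ≢ parent z) ⊎ (z′ ∉ S × orientation (root z′) ≡ just (not t)) → Anchor z′ (sideLow (not t) 0 k) (sideHigh (not t) 0 k)
          from (inj₁ (z′∈S , _)) = anchor-here z′∈S
          from (inj₂ (z′∉S , oriented′)) = ancestor (level z′) z′ , ancestor-level-∈S z′ , _ ,
            treeWalk (level z′) z′ ≤-refl z′∈ ,
            treeWalk-colours (level z′) z′ ≤-refl z′∈ oriented′
              (λ (_ , no-exit) → no-exit (z′ , z , CrossEdge⇒ExitEdge {orientation} (CrossEdge-sym {orientation} cross z′∉S)))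
              z≤n (level≤k z′) k≤K

    -- down the tree from w to z, across to z′, then into S
    throughCross : ∃ λ s → s ∈ S × ∃₂ λ l (walk : Walk InExtendedAdj w s l) →
      Unique (edgeColours colour′ walk) × All (InRange (q + throughLow t (level w)) (q + throughHigh t (level w))) (edgeColours colour′ walk)
    throughCross = via z′-anchor
      where
        via : Anchor z′ (sideLow (not t) 0 k) (sideHigh (not t) 0 k) → _
        via (s , s∈S , _ , walk′ , distinct′ , range′) =
          s , s∈S , _ , walk , subst Unique (sym colours) (proj₁ combined) , subst (All _) (sym colours) (proj₂ combined)
          where
            up = treeWalk j z j≤level z∈
            walk = reverseʷ (InducedAdj-sym G) up ++ʷ cons (e , z∈ , z′∈) walk′
            colours : edgeColours colour′ walk ≡ reverse (edgeColours colour′ up) ++ (q + k) ∷ edgeColours colour′ walk′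
            colours = trans (edgeColours-++ colour′ (reverseʷ (InducedAdj-sym G) up) _)
                            (cong₂ _++_ (edgeColours-reverse (InducedAdj-sym G) colour′ colour′-sym up)
                                        (cong (_∷ edgeColours colour′ walk′) (colour′-cross cross)))
            up-colours = treeWalk-colours j z j≤level z∈ oriented ¬root (≤-reflexive (level-ancestor j z)) (level≤k z) k≤K
            combined = through-colours t (level≤k w) (unique-reverse (proj₁ up-colours)) (all-reverse (proj₂ up-colours)) distinct′ range′

    belowW : Anchor w (sideLow t 0 (level w)) (sideHigh t 0 (level w))
    belowW = ancestor (level w) w , ancestor-level-∈S w , _ , treeWalk (level w) w ≤-refl w∈ ,
             treeWalk-colours (level w) w ≤-refl w∈ (trans (cong orientation root-w) oriented)
               (λ br → ¬root (subst BridgeRoot root-w br)) z≤n ≤-refl (≤-trans (level≤k w) k≤K)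

  crossAnchors : ∀ {z z′} → CrossEdge orientation z z′ → ∀ {j} → j ≤ level z → ancestor j z ∉ S → Anchors (ancestor j z)
  crossAnchors {z} (e , z∉S , true , oriented , far) {j} j≤level w∉S =
    split (level w) (≤-trans (level≤k w) (≤-trans k≤K K≤M)) belowW (Anchor-weaken ≤-refl K≤M throughCross)
    where
      open CrossEdgeAnchors e z∉S true oriented far j≤level w∉S
      w = ancestor j z
  crossAnchors {z} (e , z∉S , false , oriented , far) {j} j≤level w∉S =
    split (K ∸ level w) (≤-trans (m∸n≤m K (level w)) K≤M) throughCross (Anchor-weaken ≤-refl K≤M belowW)
    where
      open CrossEdgeAnchors e z∉S false oriented far j≤level w∉S
      w = ancestor j z

  anchors : ∀ {x} → x ∈ Extended → Anchors x
  anchors {x} x∈ with ∈-fromDecidable⁻ inExtended? x∈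
  ... | inj₁ x∈S = split 0 z≤n (anchor-here x∈S) (anchor-here x∈S)
  ... | inj₂ (inj₁ br) = bridgeAnchors x∈ br
  ... | inj₂ (inj₂ (z , z′ , cross , j , s≤s j≤level , refl)) with ancestor j z ∈? S
  ...   | yes x∈S = split 0 z≤n (anchor-here x∈S) (anchor-here x∈S)
  ...   | no x∉S = crossAnchors cross j≤level x∉S

  private
    bridgeColour< : ∀ {x} → BridgeRoot x → suc (treeColour x) ≤ M
    bridgeColour< br = ≤-trans (subst (_< _) (sym (treeColour-bridgeRoot br)) (bridgeIndex<bridgeCount br)) (m≤n⊔m K bridgeCount)

    split-meets-bridge : ∀ {x y} s → s ≤ M → Anchor x 0 s → Anchor x s M → BridgeRoot y →
                         Anchor y (treeColour y) (suc (treeColour y)) → RainbowWalk InExtendedAdj (q + M) colour′ x y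
    split-meets-bridge {y = y} s s≤M low high br a with treeColour y <? s
    ... | yes β<s = join high a (inj₂ β<s) ≤-refl (bridgeColour< br)
    ... | no β≮s = join low a (inj₁ (≮⇒≥ β≮s)) s≤M (bridgeColour< br)

  connect : ∀ {x y} → Anchors x → Anchors y → x ≢ y → RainbowWalk InExtendedAdj (q + M) colour′ x y
  connect (split s s≤M low high) (split s′ s′≤M low′ high′) _ with s ≤? s′
  ... | yes s≤s′ = join low high′ (inj₁ s≤s′) s≤M ≤-refl
  ... | no s≰s′ = join high low′ (inj₂ (<⇒≤ (≰⇒> s≰s′))) ≤-refl s′≤M
  connect (split s s≤M low high) (bridge br a) _ = split-meets-bridge s s≤M low high br a
  connect (bridge br a) (split s s≤M low high) _ =
    RainbowWalk-sym (InducedAdj-sym G) colour′-sym (split-meets-bridge s s≤M low high br a)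
  connect {x} {y} (bridge br a) (bridge br′ a′) x≢y with <-cmp (treeColour x) (treeColour y)
  ... | tri< β<β′ _ _ = join a a′ (inj₁ β<β′) (bridgeColour< br) (bridgeColour< br′)
  ... | tri> _ _ β′<β = join a a′ (inj₂ β′<β) (bridgeColour< br) (bridgeColour< br′)
  ... | tri≈ _ β≡β′ _ = ⊥-elim (x≢y (bridgeIndex-injective br br′
                          (trans (sym (treeColour-bridgeRoot br)) (trans β≡β′ (treeColour-bridgeRoot br′)))))

  Extended-rainbow : RainbowIn G Extended (q + M) colour′
  Extended-rainbow x y x∈ y∈ with x Fin.≟ y
  ... | yes refl = 0 , nil x , [] , []
  ... | no x≢y = connect (anchors x∈) (anchors y∈) x≢y

module _ {G : Graph} {S : Subset (n G)} {q : ℕ} {c : V G → V G → ℕ} where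

  private
    colors-mod : .{{_ : NonZero q}} → ∀ {x y l} (w : Walk (InducedAdj G S) x y l) →
                 colors G (λ a b → c a b mod q) (mapʷ proj₁ w) ≡ map (_mod q) (edgeColours c w)
    colors-mod (nil _) = refl
    colors-mod (cons _ w) = cong (_ ∷_) (colors-mod w)

    unique-mod : .{{_ : NonZero q}} → ∀ {cs} → All (_< q) cs → Unique cs → Unique (map (_mod q) cs)
    unique-mod {cs} below distinct = Unique.map⁻ {f = toℕ} (subst Unique (sym toℕ∘mod) distinct)
      where
        toℕ∘mod : map toℕ (map (_mod q) cs) ≡ cs
        toℕ∘mod = trans (sym (map-∘ cs)) (map-id-local (All.map (λ c<q → trans (Fin.toℕ-fromℕ< _) (m<n⇒m%n≡m c<q)) below))

  RainbowIn⇒RcLe : .{{_ : NonZero q}} → (∀ x y → c x y ≡ c y x) → (∀ x → x ∈ S) → RainbowIn G S q c → RcLe G q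
  RainbowIn⇒RcLe c-sym everything rainbow = (λ x y → c x y mod q) , (λ x y → cong (_mod q) (c-sym x y)) , λ x y _ →
    let (l , w , distinct , below) = rainbow x y (everything x) (everything y) in
    l , mapʷ proj₁ w , subst Unique (sym (colors-mod w)) (unique-mod below distinct)

record Stage (G : Graph) : Set where
  field
    D : Subset (n G)
    bound : ℕ
    colour : V G → V G → ℕ
    colour-sym : ∀ x y → colour x y ≡ colour y x
    rainbow : RainbowIn G D bound colour

open Stage

record Extension (G : Graph) (k : ℕ) (st : Stage G) : Set where
  field
    bridgeCount : ℕ
    counted : CountIs (BridgeIn G (D st)) bridgeCount
    next : Stage G
    grows : D st ⊆ D next
    dominating : StepDominating G (k ∸ 1) (D next)
    next-bound : bound next ≡ bound st + ((2 * k + 1) ⊔ bridgeCount)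

extend : ∀ {G} → Connected G → ∀ k (st : Stage G) → StepDominating G k (D st) → Extension G k st
extend {G} conn k st dom = record
  { bridgeCount = bridgeCount
  ; counted = bridgeCount-spec
  ; next = record { D = Extended ; bound = bound st + M ; colour = colour′ ; colour-sym = colour′-sym ; rainbow = Extended-rainbow }
  ; grows = S⊆Extended
  ; dominating = Extended-dominating
  ; next-bound = refl
  }
  where open Recolouring G conn (D st) k dom (bound st) (colour st) (colour-sym st) (rainbow st)

centre : ∀ G (u : V G) → Stage G
centre G u = record { D = ⁅ u ⁆ ; bound = 0 ; colour = λ _ _ → 0 ; colour-sym = λ _ _ → refl ; rainbow = single }
  where
    single : RainbowIn G ⁅ u ⁆ 0 (λ _ _ → 0)
    single x y x∈ y∈ with x∈⁅y⁆⇒x≡y u x∈ | x∈⁅y⁆⇒x≡y u y∈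
    ... | refl | refl = 0 , nil x , [] , []

StepDominating-0⇒full : ∀ {G S} → StepDominating G 0 S → ∀ x → x ∈ S
StepDominating-0⇒full dom x with dom x
... | s , s∈S , zero , _ , nil _ = s∈S

sum1to-positive : ∀ g {m} → 1 ≤ m → 0 < g m → 0 < sum1to g m
sum1to-positive g {suc m} _ 0<g = ≤-trans 0<g (m≤n+m (g (suc m)) (sum1to g m))

module Descent (G : Graph) (conn : Connected G) (r : ℕ) (u : V G) (ecc : ∀ x → DistLe G u x r) where

  -- stage j: the set D^{r−j}, obtained from {u} by j extensions
  stage : ∀ j → Σ (Stage G) λ st → StepDominating G (r ∸ j) (D st)
  stage zero = centre G u , λ v → u , x∈⁅x⁆ u , ecc v
  stage (suc j) = let e = extend conn (r ∸ j) (proj₁ (stage j)) (proj₂ (stage j)) in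
    Extension.next e , subst (λ m → StepDominating G m (D (Extension.next e))) ([m∸n]∸1≡m∸[1+n] r j) (Extension.dominating e)

  step : ∀ j → Extension G (r ∸ j) (proj₁ (stage j))
  step j = extend conn (r ∸ j) (proj₁ (stage j)) (proj₂ (stage j))

  layer : ℕ → Subset (n G)
  layer zero = ⊤
  layer (suc i) = D (proj₁ (stage (r ∸ suc i)))

  bridgesAt : ℕ → ℕ
  bridgesAt i = Extension.bridgeCount (step (r ∸ i))

  layer-top : 1 ≤ r → layer r ≡ ⁅ u ⁆
  layer-top (s≤s {n = r′} z≤n) = cong (λ j → D (proj₁ (stage j))) (n∸n≡0 r′)

  layer-connected-dominating : ∀ i → 1 ≤ i → i < r → ConnectedSet G (layer i) × StepDominating G i (layer i)
  layer-connected-dominating (suc i) _ i<r = RainbowIn⇒ConnectedSet {G} {q = bound st} {c = colour st} (rainbow st) ,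
    subst (λ m → StepDominating G m (D st)) (m∸[m∸n]≡n (<⇒≤ i<r)) (proj₂ (stage (r ∸ suc i)))
    where st = proj₁ (stage (r ∸ suc i))

  layer-⊆ : ∀ i → i < r → layer (suc i) ⊆ layer i
  layer-⊆ zero _ _ = ∈⊤
  layer-⊆ (suc i) i<r {x} x∈ =
    subst (λ j → x ∈ D (proj₁ (stage j))) (sym (m∸n≡1+m∸[1+n] i<r)) (Extension.grows (step (r ∸ suc (suc i))) x∈)

  layer-bridges : ∀ i → 1 ≤ i → i ≤ r → CountIs (BridgeIn G (layer i)) (bridgesAt i)
  layer-bridges (suc i) _ _ = Extension.counted (step (r ∸ suc i))

  private
    f : ℕ → ℕ
    f i = (2 * i + 1) ⊔ bridgesAt i

    bound-stage : ∀ j → j ≤ r → bound (proj₁ (stage j)) + sum1to f (r ∸ j) ≡ sum1to f r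
    bound-stage zero _ = refl
    bound-stage (suc j) j<r = begin
      bound (proj₁ (stage (suc j))) + rest         ≡⟨ cong (_+ rest) (Extension.next-bound (step j)) ⟩
      bound (proj₁ (stage j)) + Mⱼ + rest          ≡⟨ +-assoc (bound (proj₁ (stage j))) Mⱼ rest ⟩
      bound (proj₁ (stage j)) + (Mⱼ + rest)        ≡⟨ cong (bound (proj₁ (stage j)) +_) (+-comm Mⱼ rest) ⟩
      bound (proj₁ (stage j)) + (rest + Mⱼ)        ≡⟨ cong (λ m → bound (proj₁ (stage j)) + (rest + m)) (sym f-level) ⟩
      bound (proj₁ (stage j)) + sum1to f (suc (r ∸ suc j)) ≡⟨ cong (λ m → bound (proj₁ (stage j)) + sum1to f m) (sym r∸j) ⟩
      bound (proj₁ (stage j)) + sum1to f (r ∸ j)   ≡⟨ bound-stage j (<⇒≤ j<r) ⟩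
      sum1to f r                                   ∎
      where
        open ≡-Reasoning
        rest = sum1to f (r ∸ suc j)
        Mⱼ = (2 * (r ∸ j) + 1) ⊔ Extension.bridgeCount (step j)
        r∸j : r ∸ j ≡ suc (r ∸ suc j)
        r∸j = m∸n≡1+m∸[1+n] j<r
        f-level : f (suc (r ∸ suc j)) ≡ Mⱼ
        f-level = trans (cong f (sym r∸j)) (cong (λ m → (2 * (r ∸ j) + 1) ⊔ Extension.bridgeCount (step m)) (m∸[m∸n]≡n (<⇒≤ j<r)))

  rc-bound : 1 ≤ r → RcLe G (sum1to f r)
  rc-bound 1≤r = subst (RcLe G) total
    (RainbowIn⇒RcLe {{>-nonZero (subst (0 <_) (sym total) positive)}} (colour-sym last) (StepDominating-0⇒full {G} dominating₀) (rainbow last))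
    where
      last = proj₁ (stage r)
      total : bound last ≡ sum1to f r
      total = trans (sym (+-identityʳ _)) (trans (cong (λ m → bound last + sum1to f m) (sym (n∸n≡0 r))) (bound-stage r ≤-refl))
      dominating₀ : StepDominating G 0 (D last)
      dominating₀ = subst (λ m → StepDominating G m (D last)) (n∸n≡0 r) (proj₂ (stage r))
      positive : 0 < sum1to f r
      positive = sum1to-positive f 1≤r (≤-trans (m≤n+m 1 (2 * r)) (m≤m⊔n _ (bridgesAt r)))

theorem2 : (G : Graph) → Connected G → (r : ℕ) → 1 ≤ r → Radius G r →
    (u : V G) → Ecc G u r →
    Σ (ℕ → Subset (n G)) λ D → Σ (ℕ → ℕ) λ b →
      D r ≡ ⁅ u ⁆ × D 0 ≡ ⊤ ×
      (∀ i → 1 ≤ i → i < r → ConnectedSet G (D i) × StepDominating G i (D i)) ×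
      (∀ i → i < r → D (suc i) ⊆ D i) ×
      (∀ i → 1 ≤ i → i ≤ r → CountIs (BridgeIn G (D i)) (b i)) ×
      RcLe G (sum1to (λ i → (2 * i + 1) ⊔ b i) r)
theorem2 G conn r 1≤r _ u (ecc , _) =
  layer , bridgesAt , layer-top 1≤r , refl , layer-connected-dominating , layer-⊆ , layer-bridges , rc-bound 1≤r
  where open Descent G conn r u ecc
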